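{- Let $\mathcal{E}^S$ assign to each finite set $X$ and $f\in\mathrm{Bool}(X)$ the set $\mathcal{E}^S(f)=\{\sim\text{ equivalence on }X:\mathrm{ic}(f\mid\sim)=\mathrm{cl}(\sim),\ \mathrm{ic}(f/{\sim})=\mathrm{ic}(f)\}$. Then $\mathcal{E}^S$ satisfies the $\star_1$ condition, does not satisfy the $\Delta$ condition, satisfies the $\delta$ condition, and satisfies the $\epsilon$ condition.
   Context: A boolean function on a finite set $X$ is a map $f:\mathcal{P}(X)\to\mathbb{Z}$ with $f(\emptyset)=0$; $\mathrm{Bool}(X)$ is the set of them; $1$ denotes the unique element of $\mathrm{Bool}(\emptyset)$. $f_{\mid Y}$ denotes restriction to $\mathcal{P}(Y)$. For disjoint $X,Y$: $f\star_1 g(A)=f(A\cap X)+g(A\cap Y)$. For nonempty $X$, $f$ is indecomposable if $f=f'\star_1f''$ with $f'\in\mathrm{Bool}(X\setminus Y)$, $f''\in\mathrm{Bool}(Y)$ forces $Y\in\{\emptyset,X\}$. Every $f\in\mathrm{Bool}(X)$ ($X\ne\emptyset$) has a unique equivalence $\sim_f^i$ on $X$ with $f$ equal to the $\star_1$-product of the $f_{\mid Y}$ over its classes $Y$, each $f_{\mid Y}$ indecomposable; $\mathrm{ic}(f)$ is its number of classes, and $\mathrm{ic}(1)=0$. $f$ is modular if $f(A)=\sum_{x\in A}f(\{x\})$ for all $A$. For an equivalence $\sim$ on $X$ with projection $\varpi_\sim$ and number of classes $\mathrm{cl}(\sim)$: $f/{\sim}(A)=f(\varpi_\sim^{ -1}(A))$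 for $A\subseteq X/{\sim}$; $f\mid\sim(A)=\sum_{Y\in X/\sim}f(A\cap Y)$ for $A\subseteq X$. If $\sim\subseteq\sim'$, $\overline{\sim'}$ is the induced equivalence on $X/{\sim}$. For a family $\mathcal{E}$ assigning to each $f\in\mathrm{Bool}(X)$ a set $\mathcal{E}(f)$ of equivalences on $X$: - $\star_1$ condition: the unique equivalence on $\emptyset$ lies in $\mathcal{E}(1)$, and for disjoint $X,Y$, $f\in\mathrm{Bool}(X)$, $g\in\mathrm{Bool}(Y)$: $\mathcal{E}(f\star_1 g)=\{\sim_X\sqcup\sim_Y:\sim_X\in\mathcal{E}(f),\sim_Y\in\mathcal{E}(g)\}$. - $\delta$ condition: for all $f\in\mathrm{Bool}(X)$ and equivalences $\sim\subseteq\sim'$ on $X$: ($\sim\in\mathcal{E}(f)$ and $\overline{\sim'}\in\mathcal{E}(f/{\sim})$) iff ($\sim'\in\mathcal{E}(f)$ and $\sim\in\mathcal{E}(f\mid\sim')$). - $\Delta$ condition: for disjoint $X,Y$, $f\in\mathrm{Bool}(X\sqcup Y)$, equivalences $\sim_X$ on $X$, $\sim_Y$ on $Y$: $\sim_X\sqcup\sim_Y\in\mathcal{E}(f)$ iff $\sim_X\in\mathcal{E}(f_{\mid X})$ and $\sim_Y\in\mathcal{E}(f_{\mid Y})$. - $\epsilon$ condition: for all $f\in\mathrm{Bool}(X)$: $\sim_f^i$ and the equality $=_X$ lie in $\mathcal{E}(f)$; for $\sim\in\mathcal{E}(f)$, $f\mid\sim$ is modular iff $\sim$ is $=_X$; for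 $\sim\in\mathcal{E}(f)$, $f/{\sim}$ is modular iff $\sim=\sim_f^i$. -}

module Defs where

open import Data.Nat using (ℕ; zero; suc; _+_)
open import Data.Integer using (ℤ; 0ℤ) renaming (_+_ to _+ℤ_)
open import Data.Fin using (Fin; zero; suc; _↑ˡ_; _↑ʳ_; splitAt; join; _≟_)
open import Data.Fin.Properties using (splitAt-↑ˡ; splitAt-↑ʳ; join-splitAt)
open import Data.Fin.Subset using (Subset; ⊥; _∩_; ∁; _⊆_; Nonempty; ⁅_⁆)
open import Data.Vec using (Vec; tabulate; lookup; take; drop; _++_)
open import Data.Bool using (Bool; true; false; if_then_else_)
open import Data.Product using (Σ; Σ-syntax; ∃; ∃-syntax; _×_; _,_; proj₁; proj₂)
open import Data.Sum using (_⊎_; inj₁; inj₂; [_,_]′)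
open import Function using (id; _∘_)
open import Function.Bundles using (_⇔_)
open import Relation.Nullary using (¬_)
open import Relation.Nullary.Decidable using (⌊_⌋)
open import Relation.Binary.PropositionalEquality using (_≡_; refl; sym; trans; cong; subst)

-- Finite sets are modelled as  Fin n ; subsets as  Subset n ;
-- a (raw) boolean function on Fin n is a map  Subset n → ℤ
-- (membership in Bool(X), i.e. f ⊥ ≡ 0, is imposed as a hypothesis).

BFun : ℕ → Set
BFun n = Subset n → ℤ

sumFin : ∀ {k} → (Fin k → ℤ) → ℤ
sumFin {zero}  g = 0ℤ
sumFin {suc k} g = g zero +ℤ sumFin (λ i → g (suc i))

-- An equivalence on Fin n is represented by a surjection onto a set of
-- class labels Fin k (k = number of classes); x ∼ y iff cls x ≡ cls y.

record Equiv (n : ℕ) : Set where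
  field
    k    : ℕ
    cls  : Fin n → Fin k
    surj : (a : Fin k) → ∃[ x ] cls x ≡ a
open Equiv public

cl : ∀ {n} → Equiv n → ℕ
cl e = k e

_≈ₑ_ : ∀ {n} → Equiv n → Equiv n → Set
e ≈ₑ e' = ∀ x y → (cls e x ≡ cls e y) ⇔ (cls e' x ≡ cls e' y)

_⊆ₑ_ : ∀ {n} → Equiv n → Equiv n → Set
e ⊆ₑ e' = ∀ x y → cls e x ≡ cls e y → cls e' x ≡ cls e' y

idEq : ∀ n → Equiv n
idEq n = record { k = n ; cls = id ; surj = λ a → a , refl }

classOf : ∀ {n} (e : Equiv n) → Fin (k e) → Subset n
classOf e a = tabulate (λ x → ⌊ cls e x ≟ a ⌋)

preimage : ∀ {n} (e : Equiv n) → Subset (k e) → Subset n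
preimage e A = tabulate (λ x → lookup A (cls e x))

_/ₑ_ : ∀ {n} → BFun n → (e : Equiv n) → BFun (k e)
(f /ₑ e) A = f (preimage e A)

_∣ₑ_ : ∀ {n} → BFun n → Equiv n → BFun n
(f ∣ₑ e) A = sumFin (λ a → f (A ∩ classOf e a))

induced : ∀ {n} (e e' : Equiv n) → e ⊆ₑ e' → Equiv (k e)
induced e e' le = record
  { k = k e'
  ; cls = λ a → cls e' (proj₁ (surj e a))
  ; surj = λ b →
      let x  = proj₁ (surj e' b)
          hx = proj₂ (surj e' b)
          x0 = proj₁ (surj e (cls e x))
          h0 = proj₂ (surj e (cls e x))
      in cls e x , trans (le x0 x h0) hx
  }

_⊔ₑ_ : ∀ {m n} → Equiv m → Equiv n → Equiv (m + n)
_⊔ₑ_ {m} {n} eX eY = record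
  { k = k eX + k eY
  ; cls = c
  ; surj = λ ℓ → subst (λ t → ∃[ x ] c x ≡ t) (join-splitAt (k eX) (k eY) ℓ)
                       (h (splitAt (k eX) ℓ))
  }
  where
  c : Fin (m + n) → Fin (k eX + k eY)
  c x = [ (λ u → cls eX u ↑ˡ k eY) , (λ v → k eX ↑ʳ cls eY v) ]′ (splitAt m x)
  h : (s : Fin (k eX) ⊎ Fin (k eY)) → ∃[ x ] c x ≡ join (k eX) (k eY) s
  h (inj₁ a) = proj₁ (surj eX a) ↑ˡ n ,
    subst (λ t → [ (λ u → cls eX u ↑ˡ k eY) , (λ v → k eX ↑ʳ cls eY v) ]′ t ≡ a ↑ˡ k eY)
          (sym (splitAt-↑ˡ m (proj₁ (surj eX a)) n))
          (cong (_↑ˡ k eY) (proj₂ (surj eX a)))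
  h (inj₂ b) = m ↑ʳ proj₁ (surj eY b) ,
    subst (λ t → [ (λ u → cls eX u ↑ˡ k eY) , (λ v → k eX ↑ʳ cls eY v) ]′ t ≡ k eX ↑ʳ b)
          (sym (splitAt-↑ʳ m n (proj₁ (surj eY b))))
          (cong (k eX ↑ʳ_) (proj₂ (surj eY b)))

-- f ⋆₁ g  on  X ⊔ Y = Fin (m + n)  (first m points = X, last n = Y)
_⋆₁_ : ∀ {m n} → BFun m → BFun n → BFun (m + n)
_⋆₁_ {m} f g A = f (take m A) +ℤ g (drop m A)

restrictL : ∀ {m n} → BFun (m + n) → BFun m
restrictL {m} {n} f A = f (A ++ ⊥)

restrictR : ∀ {m n} → BFun (m + n) → BFun n
restrictR {m} {n} f B = f (⊥ {m} ++ B)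

one : BFun 0
one _ = 0ℤ

IndecOn : ∀ {n} → BFun n → Subset n → Set
IndecOn {n} f Y =
  Nonempty Y ×
  ((Z : Subset n) → Z ⊆ Y →
     (Σ[ f' ∈ BFun n ] Σ[ f'' ∈ BFun n ]
        (f' ⊥ ≡ 0ℤ) × (f'' ⊥ ≡ 0ℤ) ×
        ((A : Subset n) → A ⊆ Y → f A ≡ f' (A ∩ ∁ Z) +ℤ f'' (A ∩ Z))) →
     (Z ≡ ⊥) ⊎ (Z ≡ Y))

Indecomposable : ∀ {n} → BFun n → Set
Indecomposable {n} f = IndecOn f (tabulate (λ _ → true))

IsIndecDecomp : ∀ {n} → BFun n → Equiv n → Set
IsIndecDecomp f e =
  ((A : _) → f A ≡ (f ∣ₑ e) A) × ((a : Fin (k e)) → IndecOn f (classOf e a))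

-- ic(f) = j  (relational form of ic, using the uniqueness of ∼_f^i)
IC : ∀ {n} → BFun n → ℕ → Set
IC {n} f j = Σ[ e ∈ Equiv n ] IsIndecDecomp f e × (cl e ≡ j)

Modular : ∀ {n} → BFun n → Set
Modular f = (A : _) → f A ≡ sumFin (λ x → if lookup A x then f ⁅ x ⁆ else 0ℤ)

Family : Set₁
Family = ∀ {n} → BFun n → Equiv n → Set

Star1Cond : Family → Set
Star1Cond E =
  ((e : Equiv 0) → E one e) ×
  (∀ {m n} (f : BFun m) (g : BFun n) → f ⊥ ≡ 0ℤ → g ⊥ ≡ 0ℤ →
     (e : Equiv (m + n)) →
     E (f ⋆₁ g) e ⇔ (Σ[ eX ∈ Equiv m ] Σ[ eY ∈ Equiv n ]
                        E f eX × E g eY × (e ≈ₑ (eX ⊔ₑ eY))))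

SmallDeltaCond : Family → Set
SmallDeltaCond E =
  ∀ {n} (f : BFun n) → f ⊥ ≡ 0ℤ → (e e' : Equiv n) (le : e ⊆ₑ e') →
    (E f e × E (f /ₑ e) (induced e e' le)) ⇔ (E f e' × E (f ∣ₑ e') e)

BigDeltaCond : Family → Set
BigDeltaCond E =
  ∀ {m n} (f : BFun (m + n)) → f ⊥ ≡ 0ℤ → (eX : Equiv m) (eY : Equiv n) →
    E f (eX ⊔ₑ eY) ⇔ (E (restrictL {m} {n} f) eX × E (restrictR {m} {n} f) eY)

EpsilonCond : Family → Set
EpsilonCond E =
  ∀ {n} (f : BFun n) → f ⊥ ≡ 0ℤ →
    ((ei : Equiv n) → IsIndecDecomp f ei → E f ei) ×
    E f (idEq n) ×
    ((e : Equiv n) → E f e → Modular (f ∣ₑ e) ⇔ (e ≈ₑ idEq n)) ×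
    ((e : Equiv n) → E f e → (ei : Equiv n) → IsIndecDecomp f ei →
        Modular (f /ₑ e) ⇔ (e ≈ₑ ei))

ES : Family
ES f e = IC (f ∣ₑ e) (cl e) × (Σ[ j ∈ ℕ ] IC (f /ₑ e) j × IC f j)

{-# OPTIONS --safe #-}

-- The key fact is that ∼_f^i is the finest equivalence along which f splits: if every class of ∼ is
-- indecomposable and f = f∣∼', each class of ∼ meets each class of ∼' in ∅ or in itself, so ∼ ⊆ ∼'.
-- Hence ic(f) is well defined, ic(f∣∼) = cl(∼) says exactly that the classes of ∼ are indecomposable,
-- and for such ∼ one has ic(f) ≤ ic(f/∼); the ε condition follows.  For ⋆₁, f ⋆₁ g splits at X, so no
-- class of an equivalence in E^S(f ⋆₁ g) meets both X and Y, and ic is additive.  For δ, indecomposable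
-- classes of ∼ and of the induced equivalence on X/∼ glue to indecomposable classes of ∼', and
-- ic(f) ≤ ic(f/∼) ≤ ic(f/∼') pins down the counts.  The Δ condition fails already on three points.

module Submission where

open import Defs

open import Data.Nat using (ℕ; zero; suc; _+_; _≤_)
import Data.Nat.Properties as ℕP
open import Data.Integer using (ℤ; 0ℤ; +_) renaming (_+_ to _+ℤ_)
import Data.Integer.Properties as ℤP
open import Data.Fin using (Fin; zero; suc; _↑ˡ_; _↑ʳ_; splitAt; _≟_; punchOut)
import Data.Fin.Properties as FinP
open import Data.Fin.Subset using (Subset; ⊥; ⊤; _∩_; ∁; _⊆_; Nonempty; ⁅_⁆)
import Data.Fin.Subset.Properties as SubsetP
open import Data.Vec using (Vec; []; _∷_; tabulate; lookup; take; drop; _++_)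
import Data.Vec.Properties as VecP
open import Data.Bool using (true; false; if_then_else_; _∧_; not)
import Data.Bool.Properties as BoolP
open import Data.Product using (_×_; Σ; Σ-syntax; ∃-syntax; _,_; proj₁; proj₂)
open import Data.Sum using (_⊎_; inj₁; inj₂)
import Data.Sum as Sum
open import Function using (_∘_)
open import Function.Bundles using (_⇔_; mk⇔; Equivalence)
open import Function.Construct.Symmetry using (⇔-sym)
open import Relation.Nullary using (¬_; Dec; yes; no; contradiction)
open import Relation.Nullary.Decidable using (⌊_⌋; _×-dec_; _→-dec_; ¬?)
import Relation.Nullary.Decidable as DecP
open import Relation.Binary.PropositionalEquality
  using (_≡_; _≢_; refl; sym; trans; cong; cong₂; subst; module ≡-Reasoning)
open import Algebra.Properties.CommutativeMonoid.Sum ℤP.+-0-commutativeMonoid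
  using (sum; sum-cong-≗; sum-replicate-zero; ∑-distrib-+; ∑-comm)
open ≡-Reasoning

sumFin≡sum : ∀ {k} (g : Fin k → ℤ) → sumFin g ≡ sum g
sumFin≡sum {zero}  g = refl
sumFin≡sum {suc k} g = cong (g zero +ℤ_) (sumFin≡sum (g ∘ suc))

sumFin-cong : ∀ {k} {g h : Fin k → ℤ} → (∀ i → g i ≡ h i) → sumFin g ≡ sumFin h
sumFin-cong {g = g} {h} g≗h = trans (sumFin≡sum g) (trans (sum-cong-≗ {x = g} {y = h} g≗h) (sym (sumFin≡sum h)))

sumFin-zero : ∀ {k} {g : Fin k → ℤ} → (∀ i → g i ≡ 0ℤ) → sumFin g ≡ 0ℤ
sumFin-zero {k} g≗0 = trans (sumFin-cong g≗0) (trans (sumFin≡sum {k} (λ _ → 0ℤ)) (sum-replicate-zero k))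

sumFin-+ : ∀ {k} (g h : Fin k → ℤ) → sumFin (λ i → g i +ℤ h i) ≡ sumFin g +ℤ sumFin h
sumFin-+ g h = begin
  sumFin (λ i → g i +ℤ h i) ≡⟨ sumFin≡sum (λ i → g i +ℤ h i) ⟩
  sum (λ i → g i +ℤ h i)    ≡⟨ ∑-distrib-+ g h ⟩
  sum g +ℤ sum h            ≡⟨ sym (cong₂ _+ℤ_ (sumFin≡sum g) (sumFin≡sum h)) ⟩
  sumFin g +ℤ sumFin h      ∎

sumFin-comm : ∀ {k l} (h : Fin k → Fin l → ℤ) →
              sumFin (λ i → sumFin (h i)) ≡ sumFin (λ j → sumFin (λ i → h i j))
sumFin-comm h = begin
  sumFin (λ i → sumFin (h i))              ≡⟨ sumFin≡sum (λ i → sumFin (h i)) ⟩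
  sum (λ i → sumFin (h i))                 ≡⟨ sum-cong-≗ {x = λ i → sumFin (h i)} (λ i → sumFin≡sum (h i)) ⟩
  sum (λ i → sum (h i))                    ≡⟨ ∑-comm h ⟩
  sum (λ j → sum (λ i → h i j))
    ≡⟨ sum-cong-≗ {y = λ j → sumFin (λ i → h i j)} (λ j → sym (sumFin≡sum (λ i → h i j))) ⟩
  sum (λ j → sumFin (λ i → h i j))         ≡⟨ sym (sumFin≡sum (λ j → sumFin (λ i → h i j))) ⟩
  sumFin (λ j → sumFin (λ i → h i j))      ∎

sumFin-single : ∀ {k} (g : Fin k → ℤ) (a : Fin k) → (∀ i → i ≢ a → g i ≡ 0ℤ) → sumFin g ≡ g a
sumFin-single g zero    g≡0 =
  trans (cong (g zero +ℤ_) (sumFin-zero (λ i → g≡0 (suc i) λ ()))) (ℤP.+-identityʳ (g zero))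
sumFin-single g (suc a) g≡0 =
  trans (cong₂ _+ℤ_ (g≡0 zero λ ()) (sumFin-single (g ∘ suc) a λ i i≢a → g≡0 (suc i) (i≢a ∘ FinP.suc-injective)))
        (ℤP.+-identityˡ _)

sumFin-↑ : ∀ a b (h : Fin (a + b) → ℤ) → sumFin h ≡ sumFin (λ i → h (i ↑ˡ b)) +ℤ sumFin (λ j → h (a ↑ʳ j))
sumFin-↑ zero    b h = sym (ℤP.+-identityˡ _)
sumFin-↑ (suc a) b h = trans (cong (h zero +ℤ_) (sumFin-↑ a b (h ∘ suc))) (sym (ℤP.+-assoc (h zero) _ _))

-- Pointwise variants of _⊆_ and Nonempty, phrased with lookup so that they compute under rewriting.
infix 4 _⊆′_

_⊆′_ : ∀ {n} → Subset n → Subset n → Set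
A ⊆′ B = ∀ x → lookup A x ≡ true → lookup B x ≡ true

Nonempty′ : ∀ {n} → Subset n → Set
Nonempty′ A = ∃[ x ] lookup A x ≡ true

⊆⇒⊆′ : ∀ {n} {A B : Subset n} → A ⊆ B → A ⊆′ B
⊆⇒⊆′ {A = A} A⊆B x x∈A = VecP.[]=⇒lookup (A⊆B (VecP.lookup⇒[]= x A x∈A))

⊆′⇒⊆ : ∀ {n} {A B : Subset n} → A ⊆′ B → A ⊆ B
⊆′⇒⊆ {B = B} A⊆B {x} x∈A = VecP.lookup⇒[]= x B (A⊆B x (VecP.[]=⇒lookup x∈A))

Nonempty⇒Nonempty′ : ∀ {n} {A : Subset n} → Nonempty A → Nonempty′ A
Nonempty⇒Nonempty′ (x , x∈A) = x , VecP.[]=⇒lookup x∈A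

Nonempty′⇒Nonempty : ∀ {n} {A : Subset n} → Nonempty′ A → Nonempty A
Nonempty′⇒Nonempty {A = A} (x , x∈A) = x , VecP.lookup⇒[]= x A x∈A

lookup-ext : ∀ {X : Set} {n} {u v : Vec X n} → (∀ i → lookup u i ≡ lookup v i) → u ≡ v
lookup-ext {u = u} {v} u≗v =
  trans (sym (VecP.tabulate∘lookup u)) (trans (VecP.tabulate-cong u≗v) (VecP.tabulate∘lookup v))

lookup-∩ : ∀ {n} (A B : Subset n) x → lookup (A ∩ B) x ≡ lookup A x ∧ lookup B x
lookup-∩ A B x = VecP.lookup-zipWith _∧_ x A B

lookup-∁ : ∀ {n} (A : Subset n) x → lookup (∁ A) x ≡ not (lookup A x)
lookup-∁ A x = VecP.lookup-map x not A

lookup-⊥ : ∀ {n} (x : Fin n) → lookup (⊥ {n}) x ≡ false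
lookup-⊥ x = VecP.lookup-replicate x false

lookup-⊤ : ∀ {n} (x : Fin n) → lookup (⊤ {n}) x ≡ true
lookup-⊤ x = VecP.lookup-replicate x true

⊆′-antisym : ∀ {n} {A B : Subset n} → A ⊆′ B → B ⊆′ A → A ≡ B
⊆′-antisym A⊆B B⊆A = SubsetP.⊆-antisym (⊆′⇒⊆ A⊆B) (⊆′⇒⊆ B⊆A)

⊆′⊥⇒≡⊥ : ∀ {n} {A : Subset n} → A ⊆′ ⊥ → A ≡ ⊥
⊆′⊥⇒≡⊥ {A = A} A⊆⊥ = ⊆′-antisym A⊆⊥ (⊆⇒⊆′ {A = ⊥} {B = A} SubsetP.⊥⊆)

∈-∩⁺ : ∀ {n} {A B : Subset n} x → lookup A x ≡ true → lookup B x ≡ true → lookup (A ∩ B) x ≡ true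
∈-∩⁺ {A = A} {B} x x∈A x∈B = trans (lookup-∩ A B x) (cong₂ _∧_ x∈A x∈B)

∩-⊆′ˡ : ∀ {n} (A B : Subset n) → A ∩ B ⊆′ A
∩-⊆′ˡ A B = ⊆⇒⊆′ (SubsetP.p∩q⊆p A B)

∩-⊆′ʳ : ∀ {n} (A B : Subset n) → A ∩ B ⊆′ B
∩-⊆′ʳ A B = ⊆⇒⊆′ (SubsetP.p∩q⊆q A B)

⊆′⇒∩≡ : ∀ {n} {A B : Subset n} → A ⊆′ B → A ∩ B ≡ A
⊆′⇒∩≡ {A = A} {B} A⊆B = ⊆′-antisym (∩-⊆′ˡ A B) (λ x x∈A → ∈-∩⁺ {A = A} {B} x x∈A (A⊆B x x∈A))

disjoint⇒∩≡⊥ : ∀ {n} {A B : Subset n} → (∀ x → lookup A x ≡ true → lookup B x ≡ false) → A ∩ B ≡ ⊥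
disjoint⇒∩≡⊥ {A = A} {B} disjoint = ⊆′⊥⇒≡⊥ λ x x∈A∩B →
  contradiction (trans (sym (disjoint x (∩-⊆′ˡ A B x x∈A∩B))) (∩-⊆′ʳ A B x x∈A∩B)) λ ()

∩-∩-comm : ∀ {n} (A B C : Subset n) → (A ∩ B) ∩ C ≡ (A ∩ C) ∩ B
∩-∩-comm A B C = begin
  (A ∩ B) ∩ C ≡⟨ SubsetP.∩-assoc A B C ⟩
  A ∩ (B ∩ C) ≡⟨ cong (A ∩_) (SubsetP.∩-comm B C) ⟩
  A ∩ (C ∩ B) ≡⟨ sym (SubsetP.∩-assoc A C B) ⟩
  (A ∩ C) ∩ B ∎

∩-∩-idem : ∀ {n} (A B : Subset n) → (A ∩ B) ∩ B ≡ A ∩ B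
∩-∩-idem A B = trans (SubsetP.∩-assoc A B B) (cong (A ∩_) (SubsetP.∩-idem B))

∩-∩-∁ : ∀ {n} (A B : Subset n) → (A ∩ B) ∩ ∁ B ≡ ⊥
∩-∩-∁ A B = trans (SubsetP.∩-assoc A B (∁ B)) (trans (cong (A ∩_) (SubsetP.∩-inverseʳ B)) (SubsetP.∩-zeroʳ A))

∩-∁-∩ : ∀ {n} (A B : Subset n) → (A ∩ ∁ B) ∩ B ≡ ⊥
∩-∁-∩ A B = trans (SubsetP.∩-assoc A (∁ B) B) (trans (cong (A ∩_) (SubsetP.∩-inverseˡ B)) (SubsetP.∩-zeroʳ A))

∉⇒∈∁ : ∀ {n} (A : Subset n) x → lookup A x ≡ false → lookup (∁ A) x ≡ true
∉⇒∈∁ A x x∉A = trans (lookup-∁ A x) (cong not x∉A)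

∈∁⇒∉ : ∀ {n} (A : Subset n) x → lookup (∁ A) x ≡ true → lookup A x ≡ false
∈∁⇒∉ A x x∈∁A = trans (sym (BoolP.not-involutive _)) (cong not (trans (sym (lookup-∁ A x)) x∈∁A))

∈-∩-lookup : ∀ {n} (Y Z : Subset n) x → lookup Y x ≡ true → lookup (Y ∩ Z) x ≡ lookup Z x
∈-∩-lookup Y Z x x∈Y = trans (lookup-∩ Y Z x) (cong (_∧ lookup Z x) x∈Y)

nonempty-or-⊥ : ∀ {n} (A : Subset n) → Nonempty′ A ⊎ A ≡ ⊥
nonempty-or-⊥ A with SubsetP.nonempty? A
... | yes A≢∅ = inj₁ (Nonempty⇒Nonempty′ A≢∅)
... | no  A≡∅ = inj₂ (SubsetP.Empty-unique A≡∅)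

∩≡⇒⊆′ : ∀ {n} {A B : Subset n} → A ∩ B ≡ A → A ⊆′ B
∩≡⇒⊆′ {A = A} {B} A∩B≡A x x∈A = ∩-⊆′ʳ A B x (subst (λ S → lookup S x ≡ true) (sym A∩B≡A) x∈A)

Nonempty′⇒≢⊥ : ∀ {n} {A : Subset n} → Nonempty′ A → A ≢ ⊥
Nonempty′⇒≢⊥ (x , x∈A) refl = contradiction (trans (sym x∈A) (lookup-⊥ x)) λ ()

x∈⁅x⁆′ : ∀ {n} (x : Fin n) → lookup ⁅ x ⁆ x ≡ true
x∈⁅x⁆′ x = VecP.[]=⇒lookup (SubsetP.x∈⁅x⁆ x)

x∈⁅y⁆⇒x≡y′ : ∀ {n} {x} (y : Fin n) → lookup ⁅ y ⁆ x ≡ true → x ≡ y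
x∈⁅y⁆⇒x≡y′ {x = x} y x∈⁅y⁆ = SubsetP.x∈⁅y⁆⇒x≡y y (VecP.lookup⇒[]= x ⁅ y ⁆ x∈⁅y⁆)

≈ₑ⇒⊆ₑ : ∀ {n} (e e' : Equiv n) → e ≈ₑ e' → e ⊆ₑ e'
≈ₑ⇒⊆ₑ e e' e≈e' x y = Equivalence.to (e≈e' x y)

≈ₑ⇒⊇ₑ : ∀ {n} (e e' : Equiv n) → e ≈ₑ e' → e' ⊆ₑ e
≈ₑ⇒⊇ₑ e e' e≈e' x y = Equivalence.from (e≈e' x y)

⊆ₑ-antisym : ∀ {n} (e e' : Equiv n) → e ⊆ₑ e' → e' ⊆ₑ e → e ≈ₑ e'
⊆ₑ-antisym e e' e⊆e' e'⊆e x y = mk⇔ (e⊆e' x y) (e'⊆e x y)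

⊆ₑ-refl : ∀ {n} (e : Equiv n) → e ⊆ₑ e
⊆ₑ-refl e _ _ x~y = x~y

≈ₑ-sym : ∀ {n} (e e' : Equiv n) → e ≈ₑ e' → e' ≈ₑ e
≈ₑ-sym e e' e≈e' x y = ⇔-sym (e≈e' x y)

rep : ∀ {n} (e : Equiv n) → Fin (k e) → Fin n
rep e a = proj₁ (surj e a)

cls-rep : ∀ {n} (e : Equiv n) a → cls e (rep e a) ≡ a
cls-rep e a = proj₂ (surj e a)

lookup-classOf : ∀ {n} (e : Equiv n) a x → lookup (classOf e a) x ≡ ⌊ cls e x ≟ a ⌋
lookup-classOf e a x = VecP.lookup∘tabulate _ x

∈-classOf⁺ : ∀ {n} (e : Equiv n) {a x} → cls e x ≡ a → lookup (classOf e a) x ≡ true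
∈-classOf⁺ e {a} {x} x∈a with cls e x ≟ a | lookup-classOf e a x
... | yes _  | x∈C = x∈C
... | no x∉a | _   = contradiction x∈a x∉a

∈-classOf⁻ : ∀ {n} (e : Equiv n) {a x} → lookup (classOf e a) x ≡ true → cls e x ≡ a
∈-classOf⁻ e {a} {x} x∈C with cls e x ≟ a | lookup-classOf e a x
... | yes x∈a | _    = x∈a
... | no _    | x∉C  = contradiction (trans (sym x∈C) x∉C) λ ()

∉-classOf : ∀ {n} (e : Equiv n) {a x} → cls e x ≢ a → lookup (classOf e a) x ≡ false
∉-classOf e {a} {x} x∉a with lookup (classOf e a) x in x∈C
... | true  = contradiction (∈-classOf⁻ e x∈C) x∉a
... | false = refl

rep∈classOf : ∀ {n} (e : Equiv n) a → lookup (classOf e a) (rep e a) ≡ true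
rep∈classOf e a = ∈-classOf⁺ e (cls-rep e a)

classOf-⊆′ : ∀ {n} (e e' : Equiv n) → e ⊆ₑ e' → ∀ a → classOf e a ⊆′ classOf e' (cls e' (rep e a))
classOf-⊆′ e e' e⊆e' a x x∈a = ∈-classOf⁺ e' (e⊆e' x (rep e a) (trans (∈-classOf⁻ e x∈a) (sym (cls-rep e a))))

⊆′classOf⇒∩≡⊥ : ∀ {n} (e : Equiv n) {A a b} → A ⊆′ classOf e a → b ≢ a → A ∩ classOf e b ≡ ⊥
⊆′classOf⇒∩≡⊥ e A⊆Ca b≢a =
  disjoint⇒∩≡⊥ λ x x∈A → ∉-classOf e λ x∈b → b≢a (trans (sym x∈b) (∈-classOf⁻ e (A⊆Ca x x∈A)))

⊆ₑ⇒cl≥ : ∀ {n} (e e' : Equiv n) → e ⊆ₑ e' → cl e' ≤ cl e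
⊆ₑ⇒cl≥ e e' e⊆e' = FinP.injective⇒≤ {f = λ b → cls e (rep e' b)} λ {b} {b'} eq →
  trans (sym (cls-rep e' b)) (trans (e⊆e' _ _ eq) (cls-rep e' b'))

surjective⇒injective : ∀ {m n} (σ : Fin m → Fin n) → (∀ b → ∃[ a ] σ a ≡ b) → m ≤ n →
                       ∀ {i j} → σ i ≡ σ j → i ≡ j
surjective⇒injective {suc m} {n} σ σ-surj m<n {i} {j} σi≡σj with i ≟ j
... | yes i≡j = i≡j
... | no  i≢j = contradiction (FinP.injective⇒≤ {f = τ′} τ′-injective) (ℕP.<⇒≱ m<n)
  where
  τ : Fin n → Fin (suc m)
  τ b = proj₁ (σ-surj b)
  σ∘τ : ∀ b → σ (τ b) ≡ b
  σ∘τ b = proj₂ (σ-surj b)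
  τ-injective : ∀ {b b'} → τ b ≡ τ b' → b ≡ b'
  τ-injective {b} {b'} eq = trans (sym (σ∘τ b)) (trans (cong σ eq) (σ∘τ b'))
  fixed : ∀ {z b} → τ b ≡ z → τ (σ z) ≡ z
  fixed {b = b} refl = cong τ (σ∘τ b)
  -- τ is a section of σ, so its image cannot contain both i and j
  missed : Σ[ z ∈ Fin (suc m) ] (∀ b → z ≢ τ b)
  missed with τ (σ i) ≟ i
  ... | no  τσi≢i = i , λ b i≡τb → τσi≢i (fixed (sym i≡τb))
  ... | yes τσi≡i = j , λ b j≡τb → i≢j (trans (sym τσi≡i) (trans (cong τ σi≡σj) (fixed (sym j≡τb))))
  τ′ : Fin n → Fin m
  τ′ b = punchOut (proj₂ missed b)
  τ′-injective : ∀ {b b'} → τ′ b ≡ τ′ b' → b ≡ b'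
  τ′-injective {b} {b'} eq = τ-injective (FinP.punchOut-injective (proj₂ missed b) (proj₂ missed b') eq)

⊆ₑ-cl≡⇒⊇ₑ : ∀ {n} (e e' : Equiv n) → e ⊆ₑ e' → cl e ≡ cl e' → e' ⊆ₑ e
⊆ₑ-cl≡⇒⊇ₑ e e' e⊆e' cl≡ x y x~'y =
  surjective⇒injective σ σ-surj (ℕP.≤-reflexive cl≡) (trans (σ∘cls x) (trans x~'y (sym (σ∘cls y))))
  where
  σ : Fin (k e) → Fin (k e')
  σ a = cls e' (rep e a)
  σ∘cls : ∀ x → σ (cls e x) ≡ cls e' x
  σ∘cls x = e⊆e' _ _ (cls-rep e (cls e x))
  σ-surj : ∀ b → ∃[ a ] σ a ≡ b
  σ-surj b = cls e (rep e' b) , trans (σ∘cls (rep e' b)) (cls-rep e' b)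

classOf-cong : ∀ {n} (e e' : Equiv n) → e ⊆ₑ e' → e' ⊆ₑ e → ∀ a → classOf e a ≡ classOf e' (cls e' (rep e a))
classOf-cong e e' e⊆e' e'⊆e a = ⊆′-antisym (classOf-⊆′ e e' e⊆e' a)
  (λ x x∈a' → ∈-classOf⁺ e (trans (e'⊆e _ _ (∈-classOf⁻ e' x∈a')) (cls-rep e a)))

cl≤n : ∀ {n} (e : Equiv n) → cl e ≤ n
cl≤n {n} e = ⊆ₑ⇒cl≥ (idEq n) e λ x y x≡y → cong (cls e) x≡y

indiscrete : ∀ n → Equiv (suc n)
indiscrete n = record { k = 1 ; cls = λ _ → zero ; surj = λ { zero → zero , refl } }

kernel : ∀ {m K} (c : Fin m → Fin K) → Σ[ e ∈ Equiv m ] (∀ x y → (cls e x ≡ cls e y) ⇔ (c x ≡ c y))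
kernel {zero}  c = idEq 0 , λ ()
kernel {suc m} c with kernel (c ∘ suc) | FinP.any? (λ y → c zero ≟ c (suc y))
... | e , e-ker | yes (y₀ , c₀≡cy₀) = e₀ , ker
  where
  cls₀ : Fin (suc m) → Fin (k e)
  cls₀ zero    = cls e y₀
  cls₀ (suc y) = cls e y
  e₀ : Equiv (suc m)
  e₀ = record { k = k e ; cls = cls₀ ; surj = λ b → suc (rep e b) , cls-rep e b }
  ker₀ : ∀ y → (cls e y₀ ≡ cls e y) ⇔ (c zero ≡ c (suc y))
  ker₀ y = mk⇔ (λ p → trans c₀≡cy₀ (Equivalence.to (e-ker y₀ y) p))
               (λ q → Equivalence.from (e-ker y₀ y) (trans (sym c₀≡cy₀) q))
  ker : ∀ x y → (cls₀ x ≡ cls₀ y) ⇔ (c x ≡ c y)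
  ker zero    zero    = mk⇔ (λ _ → refl) (λ _ → refl)
  ker zero    (suc y) = ker₀ y
  ker (suc x) zero    = mk⇔ (λ p → sym (Equivalence.to (ker₀ x) (sym p)))
                            (λ q → sym (Equivalence.from (ker₀ x) (sym q)))
  ker (suc x) (suc y) = e-ker x y
... | e , e-ker | no c₀-new = e₀ , ker
  where
  cls₀ : Fin (suc m) → Fin (suc (k e))
  cls₀ zero    = zero
  cls₀ (suc y) = suc (cls e y)
  e₀ : Equiv (suc m)
  e₀ = record { k = suc (k e) ; cls = cls₀
              ; surj = λ { zero → zero , refl ; (suc b) → suc (rep e b) , cong suc (cls-rep e b) } }
  ker : ∀ x y → (cls₀ x ≡ cls₀ y) ⇔ (c x ≡ c y)
  ker zero    zero    = mk⇔ (λ _ → refl) (λ _ → refl)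
  ker zero    (suc y) = mk⇔ (λ ()) (λ q → contradiction (y , q) c₀-new)
  ker (suc x) zero    = mk⇔ (λ ()) (λ q → contradiction (x , sym q) c₀-new)
  ker (suc x) (suc y) = mk⇔ (Equivalence.to (e-ker x y) ∘ FinP.suc-injective)
                            (cong suc ∘ Equivalence.from (e-ker x y))

-- Splittings and indecomposable decompositions

SplitsAlong : ∀ {n} → BFun n → Equiv n → Set
SplitsAlong g e = ∀ A → g A ≡ (g ∣ₑ e) A

SplitsAt : ∀ {n} → BFun n → Subset n → Set
SplitsAt g Z = ∀ A → g A ≡ g (A ∩ ∁ Z) +ℤ g (A ∩ Z)

SplitsWithin : ∀ {n} → BFun n → Subset n → Subset n → Set
SplitsWithin g Y Z = ∀ A → A ⊆′ Y → g A ≡ g (A ∩ ∁ Z) +ℤ g (A ∩ Z)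

-- IndecOn with the factors f', f'' of a splitting replaced by g itself; equivalent to it when g ⊥ ≡ 0ℤ.
Indec : ∀ {n} → BFun n → Subset n → Set
Indec g Y = Nonempty′ Y × (∀ Z → Z ⊆′ Y → SplitsWithin g Y Z → Z ≡ ⊥ ⊎ Z ≡ Y)

ClassesIndec : ∀ {n} → BFun n → Equiv n → Set
ClassesIndec g e = ∀ a → Indec g (classOf e a)

∣ₑ-⊥ : ∀ {n} (g : BFun n) → g ⊥ ≡ 0ℤ → (e : Equiv n) → (g ∣ₑ e) ⊥ ≡ 0ℤ
∣ₑ-⊥ g g⊥ e = sumFin-zero λ a → trans (cong g (SubsetP.∩-zeroˡ (classOf e a))) g⊥

∣ₑ-⊆′classOf : ∀ {n} (g : BFun n) → g ⊥ ≡ 0ℤ → (e : Equiv n) {A : Subset n} {a : Fin (k e)} →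
               A ⊆′ classOf e a → (g ∣ₑ e) A ≡ g A
∣ₑ-⊆′classOf g g⊥ e {a = a} A⊆Ca =
  trans (sumFin-single _ a λ b b≢a → trans (cong g (⊆′classOf⇒∩≡⊥ e A⊆Ca b≢a)) g⊥)
        (cong g (⊆′⇒∩≡ A⊆Ca))

∣ₑ-splitsAlong : ∀ {n} (g : BFun n) → g ⊥ ≡ 0ℤ → (e : Equiv n) → SplitsAlong (g ∣ₑ e) e
∣ₑ-splitsAlong g g⊥ e A = sumFin-cong λ a → sym (∣ₑ-⊆′classOf g g⊥ e (∩-⊆′ʳ A (classOf e a)))

splitsAlong-coarsen : ∀ {n} (g : BFun n) → g ⊥ ≡ 0ℤ → (e e' : Equiv n) → e ⊆ₑ e' →
                      SplitsAlong g e → SplitsAlong g e'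
splitsAlong-coarsen g g⊥ e e' e⊆e' split A = begin
  g A                                                                ≡⟨ split A ⟩
  sumFin (λ a → g (A ∩ C a))                                         ≡⟨ sumFin-cong inner ⟩
  sumFin (λ a → sumFin (λ c → g ((A ∩ C a) ∩ C' c)))
    ≡⟨ sumFin-comm (λ a c → g ((A ∩ C a) ∩ C' c)) ⟩
  sumFin (λ c → sumFin (λ a → g ((A ∩ C a) ∩ C' c)))                 ≡⟨ sumFin-cong outer ⟩
  sumFin (λ c → g (A ∩ C' c))                                        ∎
  where
  C = classOf e
  C' = classOf e'
  inner : ∀ a → g (A ∩ C a) ≡ sumFin (λ c → g ((A ∩ C a) ∩ C' c))
  inner a = sym (∣ₑ-⊆′classOf g g⊥ e' λ x x∈ → classOf-⊆′ e e' e⊆e' a x (∩-⊆′ʳ A (C a) x x∈))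
  outer : ∀ c → sumFin (λ a → g ((A ∩ C a) ∩ C' c)) ≡ g (A ∩ C' c)
  outer c = trans (sumFin-cong λ a → cong g (∩-∩-comm A (C a) (C' c))) (sym (split (A ∩ C' c)))

splitsAlong⇒splitsAt-classOf : ∀ {n} (g : BFun n) → g ⊥ ≡ 0ℤ → (e : Equiv n) →
                               SplitsAlong g e → ∀ a → SplitsAt g (classOf e a)
splitsAlong⇒splitsAt-classOf g g⊥ e split a A = begin
  g A                                                          ≡⟨ split A ⟩
  sumFin (λ b → g (A ∩ C b))                                   ≡⟨ sumFin-cong piece ⟩
  sumFin (λ b → g ((A ∩ ∁ (C a)) ∩ C b) +ℤ g ((A ∩ C a) ∩ C b))
    ≡⟨ sumFin-+ (λ b → g ((A ∩ ∁ (C a)) ∩ C b)) (λ b → g ((A ∩ C a) ∩ C b)) ⟩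
  (g ∣ₑ e) (A ∩ ∁ (C a)) +ℤ (g ∣ₑ e) (A ∩ C a)                   ≡⟨ sym (cong₂ _+ℤ_ (split _) (split _)) ⟩
  g (A ∩ ∁ (C a)) +ℤ g (A ∩ C a)                                 ∎
  where
  C = classOf e
  piece : ∀ b → g (A ∩ C b) ≡ g ((A ∩ ∁ (C a)) ∩ C b) +ℤ g ((A ∩ C a) ∩ C b)
  piece b with b ≟ a
  ... | yes refl = trans (sym (ℤP.+-identityˡ _))
    (cong₂ _+ℤ_ (sym (trans (cong g (∩-∁-∩ A (C b))) g⊥)) (cong g (sym (∩-∩-idem A (C b)))))
  ... | no b≢a = trans (sym (ℤP.+-identityʳ _))
    (cong₂ _+ℤ_ (cong g (sym A∖Ca∩Cb)) (sym (trans (cong g (⊆′classOf⇒∩≡⊥ e (∩-⊆′ʳ A (C a)) b≢a)) g⊥)))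
    where
    Cb⊆∁Ca : C b ⊆′ ∁ (C a)
    Cb⊆∁Ca x x∈b = trans (lookup-∁ (C a) x)
      (cong not (∉-classOf e λ x∈a → b≢a (trans (sym (∈-classOf⁻ e x∈b)) x∈a)))
    A∖Ca∩Cb : (A ∩ ∁ (C a)) ∩ C b ≡ A ∩ C b
    A∖Ca∩Cb = trans (∩-∩-comm A (∁ (C a)) (C b))
                    (⊆′⇒∩≡ λ x x∈ → Cb⊆∁Ca x (∩-⊆′ʳ A (C b) x x∈))

Indec⇒IndecOn : ∀ {n} (g : BFun n) {Y : Subset n} → Indec g Y → IndecOn g Y
Indec⇒IndecOn g {Y} (Y≢∅ , indec) =
  Nonempty′⇒Nonempty Y≢∅ , λ Z Z⊆Y (f' , f'' , f'⊥ , f''⊥ , g≡f'⋆f'') →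
    indec Z (⊆⇒⊆′ Z⊆Y) (splits Z f' f'' f'⊥ f''⊥ λ A A⊆Y → g≡f'⋆f'' A (⊆′⇒⊆ A⊆Y))
  where
  splits : ∀ Z (f' f'' : BFun _) → f' ⊥ ≡ 0ℤ → f'' ⊥ ≡ 0ℤ →
           (∀ A → A ⊆′ Y → g A ≡ f' (A ∩ ∁ Z) +ℤ f'' (A ∩ Z)) → SplitsWithin g Y Z
  splits Z f' f'' f'⊥ f''⊥ g≡f'⋆f'' A A⊆Y = begin
    g A                           ≡⟨ g≡f'⋆f'' A A⊆Y ⟩
    f' (A ∩ ∁ Z) +ℤ f'' (A ∩ Z)   ≡⟨ sym (cong₂ _+ℤ_ g≡f' g≡f'') ⟩
    g (A ∩ ∁ Z) +ℤ g (A ∩ Z)      ∎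
    where
    g≡f' : g (A ∩ ∁ Z) ≡ f' (A ∩ ∁ Z)
    g≡f' = begin
      g (A ∩ ∁ Z)
        ≡⟨ g≡f'⋆f'' _ (λ x x∈ → A⊆Y x (∩-⊆′ˡ A (∁ Z) x x∈)) ⟩
      f' ((A ∩ ∁ Z) ∩ ∁ Z) +ℤ f'' ((A ∩ ∁ Z) ∩ Z)          ≡⟨ cong₂ _+ℤ_ (cong f' (∩-∩-idem A (∁ Z)))
                                                                          (trans (cong f'' (∩-∁-∩ A Z)) f''⊥) ⟩
      f' (A ∩ ∁ Z) +ℤ 0ℤ                                   ≡⟨ ℤP.+-identityʳ _ ⟩
      f' (A ∩ ∁ Z)                                         ∎
    g≡f'' : g (A ∩ Z) ≡ f'' (A ∩ Z)
    g≡f'' = begin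
      g (A ∩ Z)                                            ≡⟨ g≡f'⋆f'' _ (λ x x∈ → A⊆Y x (∩-⊆′ˡ A Z x x∈)) ⟩
      f' ((A ∩ Z) ∩ ∁ Z) +ℤ f'' ((A ∩ Z) ∩ Z)              ≡⟨ cong₂ _+ℤ_ (trans (cong f' (∩-∩-∁ A Z)) f'⊥)
                                                                          (cong f'' (∩-∩-idem A Z)) ⟩
      0ℤ +ℤ f'' (A ∩ Z)                                    ≡⟨ ℤP.+-identityˡ _ ⟩
      f'' (A ∩ Z)                                          ∎

IndecOn⇒Indec : ∀ {n} (g : BFun n) → g ⊥ ≡ 0ℤ → {Y : Subset n} → IndecOn g Y → Indec g Y
IndecOn⇒Indec g g⊥ (Y≢∅ , indec) =
  Nonempty⇒Nonempty′ Y≢∅ , λ Z Z⊆Y splits →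
    indec Z (⊆′⇒⊆ Z⊆Y) (g , g , g⊥ , g⊥ , λ A A⊆Y → splits A (⊆⇒⊆′ A⊆Y))

Indec-cong : ∀ {n} {g h : BFun n} {Y : Subset n} → (∀ A → A ⊆′ Y → g A ≡ h A) → Indec g Y → Indec h Y
Indec-cong {g = g} {h} {Y} g≡h (Y≢∅ , indec) = Y≢∅ , λ Z Z⊆Y splits → indec Z Z⊆Y λ A A⊆Y → begin
  g A                         ≡⟨ g≡h A A⊆Y ⟩
  h A                         ≡⟨ splits A A⊆Y ⟩
  h (A ∩ ∁ Z) +ℤ h (A ∩ Z)    ≡⟨ sym (cong₂ _+ℤ_ (g≡h _ (λ x x∈ → A⊆Y x (∩-⊆′ˡ A (∁ Z) x x∈)))
                                                 (g≡h _ (λ x x∈ → A⊆Y x (∩-⊆′ˡ A Z x x∈)))) ⟩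
  g (A ∩ ∁ Z) +ℤ g (A ∩ Z)    ∎

Indec-subsingleton : ∀ {n} (g : BFun n) {Y : Subset n} → Nonempty′ Y →
                     (∀ x y → lookup Y x ≡ true → lookup Y y ≡ true → x ≡ y) → Indec g Y
Indec-subsingleton g {Y} Y≢∅ subsingleton = Y≢∅ , λ Z Z⊆Y _ → ⊥-or-Y Z Z⊆Y
  where
  ⊥-or-Y : ∀ Z → Z ⊆′ Y → Z ≡ ⊥ ⊎ Z ≡ Y
  ⊥-or-Y Z Z⊆Y with nonempty-or-⊥ Z
  ... | inj₂ Z≡⊥      = inj₁ Z≡⊥
  ... | inj₁ (z , z∈Z) = inj₂ (⊆′-antisym Z⊆Y λ y y∈Y →
    subst (λ t → lookup Z t ≡ true) (subsingleton z y (Z⊆Y z z∈Z) y∈Y) z∈Z)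

Indec-∩-splitsWithin : ∀ {n} (g : BFun n) {Y Y' Z : Subset n} → Indec g Y → Y ⊆′ Y' → SplitsWithin g Y' Z →
                       Y ∩ Z ≡ ⊥ ⊎ Y ∩ Z ≡ Y
Indec-∩-splitsWithin g {Y} {Z = Z} (_ , indec) Y⊆Y' splits = indec (Y ∩ Z) (∩-⊆′ˡ Y Z) λ A A⊆Y →
  trans (splits A (λ x x∈A → Y⊆Y' x (A⊆Y x x∈A)))
        (cong₂ _+ℤ_ (cong g (lookup-ext (∖-agrees A A⊆Y))) (cong g (lookup-ext (∩-agrees A A⊆Y))))
  where
  ∖-agrees : ∀ A → A ⊆′ Y → ∀ x → lookup (A ∩ ∁ Z) x ≡ lookup (A ∩ ∁ (Y ∩ Z)) x
  ∖-agrees A A⊆Y x rewrite lookup-∩ A (∁ Z) x | lookup-∩ A (∁ (Y ∩ Z)) x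
                         | lookup-∁ Z x | lookup-∁ (Y ∩ Z) x | lookup-∩ Y Z x with lookup A x in x∈A
  ... | false = refl
  ... | true rewrite A⊆Y x x∈A = refl
  ∩-agrees : ∀ A → A ⊆′ Y → ∀ x → lookup (A ∩ Z) x ≡ lookup (A ∩ (Y ∩ Z)) x
  ∩-agrees A A⊆Y x rewrite lookup-∩ A Z x | lookup-∩ A (Y ∩ Z) x | lookup-∩ Y Z x with lookup A x in x∈A
  ... | false = refl
  ... | true rewrite A⊆Y x x∈A = refl

Indec⇒⊆classOf : ∀ {n} (g : BFun n) → g ⊥ ≡ 0ℤ → (e : Equiv n) → SplitsAlong g e →
                 ∀ {Y x} → Indec g Y → lookup Y x ≡ true → Y ⊆′ classOf e (cls e x)
Indec⇒⊆classOf g g⊥ e split {Y} {x} indec x∈Y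
  with Indec-∩-splitsWithin g {Y' = Y} indec (λ _ y∈Y → y∈Y)
         (λ A _ → splitsAlong⇒splitsAt-classOf g g⊥ e split (cls e x) A)
... | inj₁ Y∩C≡⊥ = contradiction (trans (sym x∈Y∩C) (trans (cong (λ S → lookup S x) Y∩C≡⊥) (lookup-⊥ x))) λ ()
  where x∈Y∩C = ∈-∩⁺ {A = Y} {classOf e (cls e x)} x x∈Y (∈-classOf⁺ e refl)
... | inj₂ Y∩C≡Y = λ y y∈Y → ∩-⊆′ʳ Y _ y (subst (λ S → lookup S y ≡ true) (sym Y∩C≡Y) y∈Y)

ClassesIndec⇒⊆ₑ : ∀ {n} (g : BFun n) → g ⊥ ≡ 0ℤ → (e e' : Equiv n) → ClassesIndec g e → SplitsAlong g e' → e ⊆ₑ e'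
ClassesIndec⇒⊆ₑ g g⊥ e e' indec split x y x~y =
  sym (∈-classOf⁻ e' (Indec⇒⊆classOf g g⊥ e' split (indec (cls e x)) (∈-classOf⁺ e refl) y (∈-classOf⁺ e (sym x~y))))

IndecOn-cong : ∀ {n} {g h : BFun n} {Y : Subset n} → (∀ A → A ⊆ Y → g A ≡ h A) → IndecOn g Y → IndecOn h Y
IndecOn-cong g≡h (Y≢∅ , indec) = Y≢∅ , λ Z Z⊆Y (f' , f'' , f'⊥ , f''⊥ , h≡f'⋆f'') →
  indec Z Z⊆Y (f' , f'' , f'⊥ , f''⊥ , λ A A⊆Y → trans (g≡h A A⊆Y) (h≡f'⋆f'' A A⊆Y))

ClassesIndec-resp : ∀ {n} (g : BFun n) (e e' : Equiv n) → e ⊆ₑ e' → e' ⊆ₑ e → ClassesIndec g e → ClassesIndec g e'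
ClassesIndec-resp g e e' e⊆e' e'⊆e indec a' =
  subst (Indec g) (sym (classOf-cong e' e e'⊆e e⊆e' a')) (indec (cls e (rep e' a')))

IsIndecDecomp⇒ClassesIndec : ∀ {n} (g : BFun n) → g ⊥ ≡ 0ℤ → (e : Equiv n) → IsIndecDecomp g e → ClassesIndec g e
IsIndecDecomp⇒ClassesIndec g g⊥ e (_ , indec) a = IndecOn⇒Indec g g⊥ (indec a)

IsIndecDecomp⁺ : ∀ {n} (g : BFun n) (e : Equiv n) → SplitsAlong g e → ClassesIndec g e → IsIndecDecomp g e
IsIndecDecomp⁺ g e split indec = split , λ a → Indec⇒IndecOn g (indec a)

IC-unique : ∀ {n} (g : BFun n) → g ⊥ ≡ 0ℤ → ∀ {j j'} → IC g j → IC g j' → j ≡ j'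
IC-unique g g⊥ (e , decomp , refl) (e' , decomp' , refl) =
  ℕP.≤-antisym (⊆ₑ⇒cl≥ e' e (refines e' e decomp' decomp)) (⊆ₑ⇒cl≥ e e' (refines e e' decomp decomp'))
  where
  refines : ∀ e e' → IsIndecDecomp g e → IsIndecDecomp g e' → e ⊆ₑ e'
  refines e e' decomp decomp' =
    ClassesIndec⇒⊆ₑ g g⊥ e e' (IsIndecDecomp⇒ClassesIndec g g⊥ e decomp) (proj₁ decomp')

IC-cong : ∀ {n} {g h : BFun n} {j} → (∀ A → g A ≡ h A) → IC g j → IC h j
IC-cong g≗h (e , (split , indec) , cl≡j) =
  e , ((λ A → trans (sym (g≗h A)) (trans (split A) (sumFin-cong λ a → g≗h (A ∩ classOf e a))))
    , λ a → IndecOn-cong (λ A _ → g≗h A) (indec a)) , cl≡j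

ClassesIndec-∣ₑ⁺ : ∀ {n} (g : BFun n) → g ⊥ ≡ 0ℤ → (e e' : Equiv n) → e ⊆ₑ e' →
                   ClassesIndec g e → ClassesIndec (g ∣ₑ e') e
ClassesIndec-∣ₑ⁺ g g⊥ e e' e⊆e' indec a =
  Indec-cong (λ A A⊆C → sym (∣ₑ-⊆′classOf g g⊥ e' λ x x∈A → classOf-⊆′ e e' e⊆e' a x (A⊆C x x∈A))) (indec a)

ClassesIndec-∣ₑ⁻ : ∀ {n} (g : BFun n) → g ⊥ ≡ 0ℤ → (e e' : Equiv n) → e ⊆ₑ e' →
                   ClassesIndec (g ∣ₑ e') e → ClassesIndec g e
ClassesIndec-∣ₑ⁻ g g⊥ e e' e⊆e' indec a =
  Indec-cong (λ A A⊆C → ∣ₑ-⊆′classOf g g⊥ e' λ x x∈A → classOf-⊆′ e e' e⊆e' a x (A⊆C x x∈A)) (indec a)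

IC-∣ₑ : ∀ {n} (g : BFun n) → g ⊥ ≡ 0ℤ → (e : Equiv n) → ClassesIndec g e → IC (g ∣ₑ e) (cl e)
IC-∣ₑ g g⊥ e indec =
  e , IsIndecDecomp⁺ (g ∣ₑ e) e (∣ₑ-splitsAlong g g⊥ e) (ClassesIndec-∣ₑ⁺ g g⊥ e e (⊆ₑ-refl e) indec) , refl

IC-∣ₑ⇒ClassesIndec : ∀ {n} (g : BFun n) → g ⊥ ≡ 0ℤ → (e : Equiv n) → IC (g ∣ₑ e) (cl e) → ClassesIndec g e
IC-∣ₑ⇒ClassesIndec g g⊥ e (e₀ , decomp , cl≡) =
  ClassesIndec-∣ₑ⁻ g g⊥ e e (⊆ₑ-refl e) (ClassesIndec-resp (g ∣ₑ e) e₀ e e₀⊆e e⊆e₀ indec₀)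
  where
  g∣⊥ = ∣ₑ-⊥ g g⊥ e
  indec₀ = IsIndecDecomp⇒ClassesIndec (g ∣ₑ e) g∣⊥ e₀ decomp
  e₀⊆e = ClassesIndec⇒⊆ₑ (g ∣ₑ e) g∣⊥ e₀ e indec₀ (∣ₑ-splitsAlong g g⊥ e)
  e⊆e₀ = ⊆ₑ-cl≡⇒⊇ₑ e₀ e e₀⊆e cl≡

ES⇒ClassesIndec : ∀ {n} (f : BFun n) → f ⊥ ≡ 0ℤ → (e : Equiv n) → ES f e → ClassesIndec f e
ES⇒ClassesIndec f f⊥ e (ic∣ , _) = IC-∣ₑ⇒ClassesIndec f f⊥ e ic∣

ES⁺ : ∀ {n} (f : BFun n) → f ⊥ ≡ 0ℤ → (e : Equiv n) → ClassesIndec f e →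
      ∀ {j} → IC (f /ₑ e) j → IC f j → ES f e
ES⁺ f f⊥ e indec ic/ ic = IC-∣ₑ f f⊥ e indec , _ , ic/ , ic

-- Quotients

lookup-preimage : ∀ {n} (e : Equiv n) B x → lookup (preimage e B) x ≡ lookup B (cls e x)
lookup-preimage e B x = VecP.lookup∘tabulate _ x

preimage-⊥ : ∀ {n} (e : Equiv n) → preimage e ⊥ ≡ ⊥
preimage-⊥ e = lookup-ext λ x → trans (lookup-preimage e ⊥ x) (trans (lookup-⊥ (cls e x)) (sym (lookup-⊥ x)))

preimage-∩ : ∀ {n} (e : Equiv n) B W → preimage e (B ∩ W) ≡ preimage e B ∩ preimage e W
preimage-∩ e B W = lookup-ext λ x → begin
  lookup (preimage e (B ∩ W)) x                   ≡⟨ lookup-preimage e (B ∩ W) x ⟩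
  lookup (B ∩ W) (cls e x)                        ≡⟨ lookup-∩ B W (cls e x) ⟩
  lookup B (cls e x) ∧ lookup W (cls e x)
    ≡⟨ sym (cong₂ _∧_ (lookup-preimage e B x) (lookup-preimage e W x)) ⟩
  lookup (preimage e B) x ∧ lookup (preimage e W) x ≡⟨ sym (lookup-∩ (preimage e B) (preimage e W) x) ⟩
  lookup (preimage e B ∩ preimage e W) x          ∎

preimage-∁ : ∀ {n} (e : Equiv n) W → preimage e (∁ W) ≡ ∁ (preimage e W)
preimage-∁ e W = lookup-ext λ x → begin
  lookup (preimage e (∁ W)) x      ≡⟨ lookup-preimage e (∁ W) x ⟩
  lookup (∁ W) (cls e x)           ≡⟨ lookup-∁ W (cls e x) ⟩
  not (lookup W (cls e x))         ≡⟨ sym (cong not (lookup-preimage e W x)) ⟩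
  not (lookup (preimage e W) x)    ≡⟨ sym (lookup-∁ (preimage e W) x) ⟩
  lookup (∁ (preimage e W)) x      ∎

preimage-idEq : ∀ {n} (A : Subset n) → preimage (idEq n) A ≡ A
preimage-idEq A = lookup-ext (lookup-preimage (idEq _) A)

/ₑ-⊥ : ∀ {n} (g : BFun n) → g ⊥ ≡ 0ℤ → (e : Equiv n) → (g /ₑ e) ⊥ ≡ 0ℤ
/ₑ-⊥ g g⊥ e = trans (cong g (preimage-⊥ e)) g⊥

cls-induced : ∀ {n} (e e' : Equiv n) (e⊆e' : e ⊆ₑ e') x → cls (induced e e' e⊆e') (cls e x) ≡ cls e' x
cls-induced e e' e⊆e' x = e⊆e' _ _ (cls-rep e (cls e x))

/ₑ-/ₑ-induced : ∀ {n} (f : BFun n) (e e' : Equiv n) (e⊆e' : e ⊆ₑ e') →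
                ∀ B → ((f /ₑ e) /ₑ induced e e' e⊆e') B ≡ (f /ₑ e') B
/ₑ-/ₑ-induced f e e' e⊆e' B = cong f (lookup-ext λ x → begin
  lookup (preimage e (preimage ē B)) x   ≡⟨ lookup-preimage e (preimage ē B) x ⟩
  lookup (preimage ē B) (cls e x)        ≡⟨ lookup-preimage ē B (cls e x) ⟩
  lookup B (cls ē (cls e x))             ≡⟨ cong (lookup B) (cls-induced e e' e⊆e' x) ⟩
  lookup B (cls e' x)                    ≡⟨ sym (lookup-preimage e' B x) ⟩
  lookup (preimage e' B) x               ∎)
  where ē = induced e e' e⊆e'

preimage-classOf-induced : ∀ {n} (e e' : Equiv n) (e⊆e' : e ⊆ₑ e') c →
                           preimage e (classOf (induced e e' e⊆e') c) ≡ classOf e' c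
preimage-classOf-induced e e' e⊆e' c = lookup-ext λ x → begin
  lookup (preimage e (classOf ē c)) x    ≡⟨ lookup-preimage e (classOf ē c) x ⟩
  lookup (classOf ē c) (cls e x)         ≡⟨ lookup-classOf ē c (cls e x) ⟩
  ⌊ cls ē (cls e x) ≟ c ⌋                ≡⟨ cong (λ b → ⌊ b ≟ c ⌋) (cls-induced e e' e⊆e' x) ⟩
  ⌊ cls e' x ≟ c ⌋                       ≡⟨ sym (lookup-classOf e' c x) ⟩
  lookup (classOf e' c) x                ∎
  where ē = induced e e' e⊆e'

∣ₑ-/ₑ : ∀ {n} (f : BFun n) (e e' : Equiv n) (e⊆e' : e ⊆ₑ e') →
        ∀ B → ((f ∣ₑ e') /ₑ e) B ≡ ((f /ₑ e) ∣ₑ induced e e' e⊆e') B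
∣ₑ-/ₑ f e e' e⊆e' B = sumFin-cong λ c → cong f (sym (begin
  preimage e (B ∩ classOf ē c)                 ≡⟨ preimage-∩ e B (classOf ē c) ⟩
  preimage e B ∩ preimage e (classOf ē c)
    ≡⟨ cong (preimage e B ∩_) (preimage-classOf-induced e e' e⊆e' c) ⟩
  preimage e B ∩ classOf e' c                  ∎))
  where ē = induced e e' e⊆e'

/ₑ-splitsAlong-induced : ∀ {n} (f : BFun n) (e e' : Equiv n) (e⊆e' : e ⊆ₑ e') →
                         SplitsAlong f e' → SplitsAlong (f /ₑ e) (induced e e' e⊆e')
/ₑ-splitsAlong-induced f e e' e⊆e' split B = trans (split (preimage e B)) (∣ₑ-/ₑ f e e' e⊆e' B)

/ₑ-splitsAlong-idEq : ∀ {n} (f : BFun n) → f ⊥ ≡ 0ℤ → (e : Equiv n) →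
                      SplitsAlong f e → SplitsAlong (f /ₑ e) (idEq (k e))
/ₑ-splitsAlong-idEq f f⊥ e split =
  splitsAlong-coarsen (f /ₑ e) (/ₑ-⊥ f f⊥ e) (induced e e (⊆ₑ-refl e)) (idEq (k e))
    (λ a b a~b → trans (sym (cls-rep e a)) (trans a~b (cls-rep e b)))
    (/ₑ-splitsAlong-induced f e e (⊆ₑ-refl e) split)

ClassesIndec-idEq : ∀ {n} (g : BFun n) → ClassesIndec g (idEq n)
ClassesIndec-idEq {n} g x = Indec-subsingleton g (x , ∈-classOf⁺ (idEq n) refl)
  λ y z y∈x z∈x → trans (∈-classOf⁻ (idEq n) y∈x) (sym (∈-classOf⁻ (idEq n) z∈x))

IC-/ₑ-cl : ∀ {n} (f : BFun n) (e : Equiv n) → SplitsAlong (f /ₑ e) (idEq (k e)) → IC (f /ₑ e) (cl e)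
IC-/ₑ-cl f e split = idEq (k e) , IsIndecDecomp⁺ (f /ₑ e) (idEq (k e)) split (ClassesIndec-idEq (f /ₑ e)) , refl

IC≤IC-/ₑ : ∀ {n} (g : BFun n) → g ⊥ ≡ 0ℤ → (e : Equiv n) → ClassesIndec g e →
           ∀ {j j'} → IC g j → IC (g /ₑ e) j' → j ≤ j'
IC≤IC-/ₑ g g⊥ e indec (eᵢ , (split , _) , refl) (e/ , decomp/ , refl) = ⊆ₑ⇒cl≥ e/ ē e/⊆ē
  where
  g/⊥ = /ₑ-⊥ g g⊥ e
  e⊆eᵢ = ClassesIndec⇒⊆ₑ g g⊥ e eᵢ indec split
  ē = induced e eᵢ e⊆eᵢ
  e/⊆ē = ClassesIndec⇒⊆ₑ (g /ₑ e) g/⊥ e/ ē (IsIndecDecomp⇒ClassesIndec (g /ₑ e) g/⊥ e/ decomp/)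
                         (/ₑ-splitsAlong-induced g e eᵢ e⊆eᵢ split)

Modular⇔SplitsAlong-idEq : ∀ {n} (g : BFun n) → g ⊥ ≡ 0ℤ → Modular g ⇔ SplitsAlong g (idEq n)
Modular⇔SplitsAlong-idEq {n} g g⊥ =
  mk⇔ (λ mod A → trans (mod A) (sumFin-cong λ x → sym (atom A x)))
      (λ split A → trans (split A) (sumFin-cong (atom A)))
  where
  C = classOf (idEq n)
  atom : ∀ A x → g (A ∩ C x) ≡ (if lookup A x then g ⁅ x ⁆ else 0ℤ)
  atom A x with lookup A x in x∈A
  ... | true  = cong g (⊆′-antisym
    (λ y y∈ → subst (λ t → lookup ⁅ x ⁆ t ≡ true) (sym (∈-classOf⁻ (idEq n) (∩-⊆′ʳ A (C x) y y∈))) (x∈⁅x⁆′ x))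
    (λ y y∈⁅x⁆ → case-≡ (x∈⁅y⁆⇒x≡y′ x y∈⁅x⁆)))
    where
    case-≡ : ∀ {y} → y ≡ x → lookup (A ∩ C x) y ≡ true
    case-≡ refl = ∈-∩⁺ {A = A} {C x} x x∈A (∈-classOf⁺ (idEq n) refl)
  ... | false = trans (cong g (disjoint⇒∩≡⊥ λ y y∈A → ∉-classOf (idEq n) λ { refl →
                  contradiction (trans (sym y∈A) x∈A) λ () })) g⊥

ClassesIndec-induced-⊇ : ∀ {n} (e e' : Equiv n) (e⊆e' : e ⊆ₑ e') → e' ⊆ₑ e →
                         (g : BFun (k e)) → ClassesIndec g (induced e e' e⊆e')
ClassesIndec-induced-⊇ e e' e⊆e' e'⊆e g c =
  Indec-subsingleton g (cls e (rep e' c) , ∈-classOf⁺ ē (trans (cls-induced e e' e⊆e' (rep e' c)) (cls-rep e' c)))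
    λ a b a∈c b∈c → trans (sym (cls-rep e a))
                          (trans (e'⊆e _ _ (trans (∈-classOf⁻ ē a∈c) (sym (∈-classOf⁻ ē b∈c)))) (cls-rep e b))
  where ē = induced e e' e⊆e'

-- Existence of the indecomposable decomposition

ProperSplitting : ∀ {n} → BFun n → Equiv n → Set
ProperSplitting {n} g e = Σ[ a ∈ Fin (k e) ] Σ[ Z ∈ Subset n ]
  Z ⊆′ classOf e a × SplitsWithin g (classOf e a) Z × Z ≢ ⊥ × Z ≢ classOf e a

¬ProperSplitting⇒ClassesIndec : ∀ {n} (g : BFun n) (e : Equiv n) → ¬ ProperSplitting g e → ClassesIndec g e
¬ProperSplitting⇒ClassesIndec g e ¬proper a = (rep e a , rep∈classOf e a) , ⊥-or-C
  where
  ⊥-or-C : ∀ Z → Z ⊆′ classOf e a → SplitsWithin g (classOf e a) Z → Z ≡ ⊥ ⊎ Z ≡ classOf e a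
  ⊥-or-C Z Z⊆C splits with VecP.≡-dec BoolP._≟_ Z ⊥ | VecP.≡-dec BoolP._≟_ Z (classOf e a)
  ... | yes Z≡⊥ | _        = inj₁ Z≡⊥
  ... | no  _   | yes Z≡C  = inj₂ Z≡C
  ... | no  Z≢⊥ | no  Z≢C  = contradiction (a , Z , Z⊆C , splits , Z≢⊥ , Z≢C) ¬proper

_⊆′?_ : ∀ {n} (A B : Subset n) → Dec (A ⊆′ B)
A ⊆′? B = FinP.all? λ x → (lookup A x BoolP.≟ true) →-dec (lookup B x BoolP.≟ true)

splitsWithin? : ∀ {n} (g : BFun n) Y Z → Dec (SplitsWithin g Y Z)
splitsWithin? g Y Z with SubsetP.anySubset? (λ A → (A ⊆′? Y) ×-dec ¬? (g A ℤP.≟ (g (A ∩ ∁ Z) +ℤ g (A ∩ Z))))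
... | yes (A , A⊆Y , ¬splits) = no λ splits → ¬splits (splits A A⊆Y)
... | no ¬counterexample = yes λ A A⊆Y →
  DecP.decidable-stable (g A ℤP.≟ _) λ ¬splits → ¬counterexample (A , A⊆Y , ¬splits)

properSplitting? : ∀ {n} (g : BFun n) (e : Equiv n) → Dec (ProperSplitting g e)
properSplitting? g e = FinP.any? λ a → SubsetP.anySubset? λ Z →
  (Z ⊆′? classOf e a) ×-dec splitsWithin? g (classOf e a) Z ×-dec
  ¬? (VecP.≡-dec BoolP._≟_ Z ⊥) ×-dec ¬? (VecP.≡-dec BoolP._≟_ Z (classOf e a))

coarsestSplitting : ∀ {n} (g : BFun n) → g ⊥ ≡ 0ℤ → Σ (Equiv n) (SplitsAlong g)
coarsestSplitting {zero}  g g⊥ = idEq 0 , λ { [] → g⊥ }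
coarsestSplitting {suc n} g g⊥ = indiscrete n , λ A →
  sym (trans (ℤP.+-identityʳ _) (cong g (⊆′⇒∩≡ λ x _ → ∈-classOf⁺ (indiscrete n) {x = x} refl)))

module Refinement {n} (g : BFun n) (g⊥ : g ⊥ ≡ 0ℤ) (e : Equiv n) (split : SplitsAlong g e)
                  (a : Fin (k e)) (Z : Subset n) (Z⊆Ca : Z ⊆′ classOf e a)
                  (splitsZ : SplitsWithin g (classOf e a) Z) (Z≢⊥ : Z ≢ ⊥) (Z≢Ca : Z ≢ classOf e a) where

  private
    C = classOf e

  ∉Z : ∀ {b x} → b ≢ a → lookup (C b) x ≡ true → lookup Z x ≡ false
  ∉Z {x = x} b≢a x∈Cb with lookup Z x in x∈Z
  ... | true  = contradiction (trans (sym (∈-classOf⁻ e x∈Cb)) (∈-classOf⁻ e (Z⊆Ca x x∈Z))) b≢a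
  ... | false = refl

  refinedCls : Fin n → Fin (suc (k e))
  refinedCls x = if lookup Z x then zero else suc (cls e x)

  refinedCls-∉Z : ∀ {x} → lookup Z x ≡ false → refinedCls x ≡ suc (cls e x)
  refinedCls-∉Z {x} x∉Z = cong (λ t → if t then zero else suc (cls e x)) x∉Z

  refinedCls-surj : ∀ b → ∃[ x ] refinedCls x ≡ b
  refinedCls-surj zero with nonempty-or-⊥ Z
  ... | inj₁ (z , z∈Z) = z , cong (λ t → if t then zero else suc (cls e z)) z∈Z
  ... | inj₂ Z≡⊥       = contradiction Z≡⊥ Z≢⊥
  refinedCls-surj (suc b) with b ≟ a
  ... | no b≢a = rep e b , trans (refinedCls-∉Z (∉Z b≢a (rep∈classOf e b))) (cong suc (cls-rep e b))
  ... | yes refl with nonempty-or-⊥ (C b ∩ ∁ Z)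
  ...   | inj₁ (x , x∈Cb∖Z) =
    x , trans (refinedCls-∉Z (∈∁⇒∉ Z x (∩-⊆′ʳ (C b) (∁ Z) x x∈Cb∖Z)))
              (cong suc (∈-classOf⁻ e (∩-⊆′ˡ (C b) (∁ Z) x x∈Cb∖Z)))
  ...   | inj₂ Cb∖Z≡⊥ = contradiction (⊆′-antisym Z⊆Ca Ca⊆Z) Z≢Ca
    where
    Ca⊆Z : C b ⊆′ Z
    Ca⊆Z x x∈Cb with lookup Z x in x∈Z
    ... | true  = refl
    ... | false = contradiction
      (trans (sym (∈-∩⁺ {A = C b} {∁ Z} x x∈Cb (∉⇒∈∁ Z x x∈Z))) (trans (cong (λ S → lookup S x) Cb∖Z≡⊥) (lookup-⊥ x)))
      λ ()

  refined : Equiv n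
  refined = record { k = suc (k e) ; cls = refinedCls ; surj = refinedCls-surj }

  classOf-refined-zero : classOf refined zero ≡ Z
  classOf-refined-zero = lookup-ext λ x → trans (lookup-classOf refined zero x) (atom x)
    where
    atom : ∀ x → ⌊ refinedCls x ≟ zero ⌋ ≡ lookup Z x
    atom x with lookup Z x
    ... | true  = refl
    ... | false = refl

  classOf-refined-suc : ∀ b → classOf refined (suc b) ≡ C b ∩ ∁ Z
  classOf-refined-suc b = lookup-ext λ x → begin
    lookup (classOf refined (suc b)) x          ≡⟨ lookup-classOf refined (suc b) x ⟩
    ⌊ refinedCls x ≟ suc b ⌋                    ≡⟨ atom x ⟩
    ⌊ cls e x ≟ b ⌋ ∧ not (lookup Z x)          ≡⟨ sym (cong₂ _∧_ (lookup-classOf e b x) (lookup-∁ Z x)) ⟩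
    lookup (C b) x ∧ lookup (∁ Z) x             ≡⟨ sym (lookup-∩ (C b) (∁ Z) x) ⟩
    lookup (C b ∩ ∁ Z) x                        ∎
    where
    atom : ∀ x → ⌊ refinedCls x ≟ suc b ⌋ ≡ ⌊ cls e x ≟ b ⌋ ∧ not (lookup Z x)
    atom x with lookup Z x
    ... | true  = sym (BoolP.∧-zeroʳ _)
    ... | false = trans (DecP.⌊⌋-map′ (cong suc) FinP.suc-injective (cls e x ≟ b)) (sym (BoolP.∧-identityʳ _))

  splitsAt-Z-in-class : ∀ A b → g (A ∩ C b) ≡ g ((A ∩ C b) ∩ ∁ Z) +ℤ g ((A ∩ C b) ∩ Z)
  splitsAt-Z-in-class A b with b ≟ a
  ... | yes refl = splitsZ (A ∩ C b) (∩-⊆′ʳ A (C b))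
  ... | no  b≢a  = begin
    g (A ∩ C b)                                    ≡⟨ sym (ℤP.+-identityʳ _) ⟩
    g (A ∩ C b) +ℤ 0ℤ
      ≡⟨ cong₂ _+ℤ_ (cong g (sym A∩Cb∖Z)) (sym (trans (cong g A∩Cb∩Z) g⊥)) ⟩
    g ((A ∩ C b) ∩ ∁ Z) +ℤ g ((A ∩ C b) ∩ Z)       ∎
    where
    A∩Cb∩Z : (A ∩ C b) ∩ Z ≡ ⊥
    A∩Cb∩Z = disjoint⇒∩≡⊥ λ x x∈ → ∉Z b≢a (∩-⊆′ʳ A (C b) x x∈)
    A∩Cb∖Z : (A ∩ C b) ∩ ∁ Z ≡ A ∩ C b
    A∩Cb∖Z = ⊆′⇒∩≡ λ x x∈ → ∉⇒∈∁ Z x (∉Z b≢a (∩-⊆′ʳ A (C b) x x∈))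

  splitsAlong-refined : SplitsAlong g refined
  splitsAlong-refined A = begin
    g A                                                                      ≡⟨ split A ⟩
    sumFin (λ b → g (A ∩ C b))
      ≡⟨ sumFin-cong (splitsAt-Z-in-class A) ⟩
    sumFin (λ b → g ((A ∩ C b) ∩ ∁ Z) +ℤ g ((A ∩ C b) ∩ Z))
      ≡⟨ sumFin-+ (λ b → g ((A ∩ C b) ∩ ∁ Z)) (λ b → g ((A ∩ C b) ∩ Z)) ⟩
    sumFin (λ b → g ((A ∩ C b) ∩ ∁ Z)) +ℤ sumFin (λ b → g ((A ∩ C b) ∩ Z))
      ≡⟨ ℤP.+-comm (sumFin (λ b → g ((A ∩ C b) ∩ ∁ Z))) (sumFin (λ b → g ((A ∩ C b) ∩ Z))) ⟩
    sumFin (λ b → g ((A ∩ C b) ∩ Z)) +ℤ sumFin (λ b → g ((A ∩ C b) ∩ ∁ Z))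
      ≡⟨ cong₂ _+ℤ_ inside-Z outside-Z ⟩
    g (A ∩ classOf refined zero) +ℤ sumFin (λ b → g (A ∩ classOf refined (suc b))) ∎
    where
    inside-Z : sumFin (λ b → g ((A ∩ C b) ∩ Z)) ≡ g (A ∩ classOf refined zero)
    inside-Z = begin
      sumFin (λ b → g ((A ∩ C b) ∩ Z))    ≡⟨ sumFin-cong (λ b → cong g (∩-∩-comm A (C b) Z)) ⟩
      sumFin (λ b → g ((A ∩ Z) ∩ C b))    ≡⟨ sym (split (A ∩ Z)) ⟩
      g (A ∩ Z)                           ≡⟨ cong (λ S → g (A ∩ S)) (sym classOf-refined-zero) ⟩
      g (A ∩ classOf refined zero)        ∎
    outside-Z : sumFin (λ b → g ((A ∩ C b) ∩ ∁ Z)) ≡ sumFin (λ b → g (A ∩ classOf refined (suc b)))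
    outside-Z = sumFin-cong λ b →
      cong g (trans (SubsetP.∩-assoc A (C b) (∁ Z)) (cong (A ∩_) (sym (classOf-refined-suc b))))

IsIndecDecomp-exists : ∀ {n} (g : BFun n) → g ⊥ ≡ 0ℤ → Σ[ e ∈ Equiv n ] IsIndecDecomp g e
IsIndecDecomp-exists {n} g g⊥ =
  refine n (proj₁ (coarsestSplitting g g⊥)) (proj₂ (coarsestSplitting g g⊥)) (ℕP.m≤n+m n _)
  where
  -- every refinement adds a class, and there are at most n classes
  refine : ∀ fuel (e : Equiv n) → SplitsAlong g e → n ≤ cl e + fuel → Σ[ e ∈ Equiv n ] IsIndecDecomp g e
  refine fuel e split n≤ with properSplitting? g e
  ... | no ¬proper = e , IsIndecDecomp⁺ g e split (¬ProperSplitting⇒ClassesIndec g e ¬proper)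
  refine zero e split n≤ | yes (a , Z , Z⊆Ca , splitsZ , Z≢⊥ , Z≢Ca) =
    contradiction (ℕP.≤-trans (cl≤n refined) (subst (n ≤_) (ℕP.+-identityʳ (cl e)) n≤)) (ℕP.n≮n (cl e))
    where open Refinement g g⊥ e split a Z Z⊆Ca splitsZ Z≢⊥ Z≢Ca
  refine (suc fuel) e split n≤ | yes (a , Z , Z⊆Ca , splitsZ , Z≢⊥ , Z≢Ca) =
    refine fuel refined splitsAlong-refined (subst (n ≤_) (ℕP.+-suc (cl e) fuel) n≤)
    where open Refinement g g⊥ e split a Z Z⊆Ca splitsZ Z≢⊥ Z≢Ca

IC-exists : ∀ {n} (g : BFun n) → g ⊥ ≡ 0ℤ → Σ ℕ (IC g)
IC-exists g g⊥ with IsIndecDecomp-exists g g⊥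
... | e , decomp = cl e , e , decomp , refl

-- The ε condition

ES-indecDecomp : ∀ {n} (f : BFun n) → f ⊥ ≡ 0ℤ → (eᵢ : Equiv n) → IsIndecDecomp f eᵢ → ES f eᵢ
ES-indecDecomp f f⊥ eᵢ decomp =
  ES⁺ f f⊥ eᵢ (IsIndecDecomp⇒ClassesIndec f f⊥ eᵢ decomp)
      (IC-/ₑ-cl f eᵢ (/ₑ-splitsAlong-idEq f f⊥ eᵢ (proj₁ decomp))) (eᵢ , decomp , refl)

ES-idEq : ∀ {n} (f : BFun n) → f ⊥ ≡ 0ℤ → ES f (idEq n)
ES-idEq f f⊥ with IC-exists f f⊥
... | _ , ic = ES⁺ f f⊥ (idEq _) (ClassesIndec-idEq f) (IC-cong (λ A → cong f (sym (preimage-idEq A))) ic) ic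

ES⇒Modular-∣ₑ⇔≈idEq : ∀ {n} (f : BFun n) → f ⊥ ≡ 0ℤ → (e : Equiv n) → ES f e → Modular (f ∣ₑ e) ⇔ (e ≈ₑ idEq n)
ES⇒Modular-∣ₑ⇔≈idEq {n} f f⊥ e es = mk⇔
  (λ mod → ⊆ₑ-antisym e (idEq n) (ClassesIndec⇒⊆ₑ (f ∣ₑ e) f∣⊥ e (idEq n)
                         (ClassesIndec-∣ₑ⁺ f f⊥ e e (⊆ₑ-refl e) (ES⇒ClassesIndec f f⊥ e es))
                         (Equivalence.to (Modular⇔SplitsAlong-idEq (f ∣ₑ e) f∣⊥) mod))
                      (λ x y x≡y → cong (cls e) x≡y))
  (λ e≈id → Equivalence.from (Modular⇔SplitsAlong-idEq (f ∣ₑ e) f∣⊥)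
              (splitsAlong-coarsen (f ∣ₑ e) f∣⊥ e (idEq n) (≈ₑ⇒⊆ₑ e (idEq n) e≈id) (∣ₑ-splitsAlong f f⊥ e)))
  where f∣⊥ = ∣ₑ-⊥ f f⊥ e

ES⇒Modular-/ₑ⇔≈indecDecomp : ∀ {n} (f : BFun n) → f ⊥ ≡ 0ℤ → (e : Equiv n) → ES f e →
                             (eᵢ : Equiv n) → IsIndecDecomp f eᵢ → Modular (f /ₑ e) ⇔ (e ≈ₑ eᵢ)
ES⇒Modular-/ₑ⇔≈indecDecomp f f⊥ e es@(_ , _ , ic/ , ic) eᵢ decomp = mk⇔
  (λ mod → ⊆ₑ-antisym e eᵢ e⊆eᵢ (⊆ₑ-cl≡⇒⊇ₑ e eᵢ e⊆eᵢ (cl-e≡j mod)))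
  (λ e≈eᵢ → Equivalence.from (Modular⇔SplitsAlong-idEq (f /ₑ e) f/⊥)
              (/ₑ-splitsAlong-idEq f f⊥ e (splitsAlong-coarsen f f⊥ eᵢ e (≈ₑ⇒⊇ₑ e eᵢ e≈eᵢ) (proj₁ decomp))))
  where
  f/⊥ = /ₑ-⊥ f f⊥ e
  e⊆eᵢ : e ⊆ₑ eᵢ
  e⊆eᵢ = ClassesIndec⇒⊆ₑ f f⊥ e eᵢ (ES⇒ClassesIndec f f⊥ e es) (proj₁ decomp)
  cl-e≡j : Modular (f /ₑ e) → cl e ≡ cl eᵢ
  cl-e≡j mod =
    trans (IC-unique (f /ₑ e) f/⊥ (IC-/ₑ-cl f e (Equivalence.to (Modular⇔SplitsAlong-idEq (f /ₑ e) f/⊥) mod)) ic/)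
          (IC-unique f f⊥ ic (eᵢ , decomp , refl))

ES-epsilon : EpsilonCond ES
ES-epsilon f f⊥ = ES-indecDecomp f f⊥ , ES-idEq f f⊥ , ES⇒Modular-∣ₑ⇔≈idEq f f⊥ , ES⇒Modular-/ₑ⇔≈indecDecomp f f⊥

-- The δ condition

splitsWithin-saturated : ∀ {n} (g : BFun n) (e e' : Equiv n) → e ⊆ₑ e' → ClassesIndec g e →
                         ∀ {c Z} → Z ⊆′ classOf e' c → SplitsWithin g (classOf e' c) Z →
                         Z ≡ preimage e (tabulate λ a → lookup Z (rep e a))
splitsWithin-saturated g e e' e⊆e' indec {c} {Z} Z⊆C' splitsZ = lookup-ext λ x →
  trans (saturated x)
        (sym (trans (lookup-preimage e W x) (VecP.lookup∘tabulate (λ a → lookup Z (rep e a)) (cls e x))))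
  where
  W = tabulate λ a → lookup Z (rep e a)
  ∉Z : ∀ y → cls e' y ≢ c → lookup Z y ≡ false
  ∉Z y y∉c with lookup Z y in y∈Z
  ... | true  = contradiction (∈-classOf⁻ e' (Z⊆C' y y∈Z)) y∉c
  ... | false = refl
  saturated : ∀ x → lookup Z x ≡ lookup Z (rep e (cls e x))
  saturated x with cls e' x ≟ c
  ... | no x∉c = trans (∉Z x x∉c) (sym (∉Z (rep e (cls e x)) λ r∈c → x∉c (trans (sym (cls-induced e e' e⊆e' x)) r∈c)))
  ... | yes x∈c = begin
    lookup Z x          ≡⟨ sym (∈-∩-lookup Ca Z x (∈-classOf⁺ e refl)) ⟩
    lookup (Ca ∩ Z) x
      ≡⟨ agree (Ca ∩ Z) (Indec-∩-splitsWithin g {Y' = classOf e' c} (indec a) Ca⊆C' splitsZ) ⟩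
    lookup (Ca ∩ Z) r   ≡⟨ ∈-∩-lookup Ca Z r (rep∈classOf e a) ⟩
    lookup Z r          ∎
    where
    a = cls e x
    r = rep e a
    Ca = classOf e a
    Ca⊆C' : Ca ⊆′ classOf e' c
    Ca⊆C' y y∈a = ∈-classOf⁺ e' (trans (e⊆e' y x (∈-classOf⁻ e y∈a)) x∈c)
    agree : ∀ S → S ≡ ⊥ ⊎ S ≡ Ca → lookup S x ≡ lookup S r
    agree S (inj₁ refl) = trans (lookup-⊥ x) (sym (lookup-⊥ r))
    agree S (inj₂ refl) = trans (∈-classOf⁺ e refl) (sym (rep∈classOf e a))

splitsWithin-/ₑ : ∀ {n} (f : BFun n) (e e' : Equiv n) (e⊆e' : e ⊆ₑ e') c W →
                  SplitsWithin f (classOf e' c) (preimage e W) →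
                  SplitsWithin (f /ₑ e) (classOf (induced e e' e⊆e') c) W
splitsWithin-/ₑ f e e' e⊆e' c W splits B B⊆C̄ = begin
  f (preimage e B)                                                          ≡⟨ splits (preimage e B) preB⊆C' ⟩
  f (preimage e B ∩ ∁ (preimage e W)) +ℤ f (preimage e B ∩ preimage e W)
    ≡⟨ sym (cong₂ _+ℤ_ (cong f preimage-∖) (cong f (preimage-∩ e B W))) ⟩
  f (preimage e (B ∩ ∁ W)) +ℤ f (preimage e (B ∩ W))                        ∎
  where
  preimage-∖ : preimage e (B ∩ ∁ W) ≡ preimage e B ∩ ∁ (preimage e W)
  preimage-∖ = trans (preimage-∩ e B (∁ W)) (cong (preimage e B ∩_) (preimage-∁ e W))
  preB⊆C' : preimage e B ⊆′ classOf e' c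
  preB⊆C' x x∈ = ∈-classOf⁺ e' (trans (sym (cls-induced e e' e⊆e' x))
    (∈-classOf⁻ (induced e e' e⊆e') (B⊆C̄ (cls e x) (trans (sym (lookup-preimage e B x)) x∈))))

ClassesIndec-glue : ∀ {n} (f : BFun n) (e e' : Equiv n) (e⊆e' : e ⊆ₑ e') →
                    ClassesIndec f e → ClassesIndec (f /ₑ e) (induced e e' e⊆e') → ClassesIndec f e'
ClassesIndec-glue f e e' e⊆e' indec indec/ c = (rep e' c , rep∈classOf e' c) , λ Z Z⊆C' splitsZ →
  ⊥-or-C' (tabulate λ a → lookup Z (rep e a)) (splitsWithin-saturated f e e' e⊆e' indec Z⊆C' splitsZ) Z⊆C' splitsZ
  where
  ē = induced e e' e⊆e'
  C' = classOf e' c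
  ⊥-or-C' : ∀ {Z} W → Z ≡ preimage e W → Z ⊆′ C' → SplitsWithin f C' Z → Z ≡ ⊥ ⊎ Z ≡ C'
  ⊥-or-C' W refl Z⊆C' splitsZ =
    Sum.map (λ W≡⊥ → trans (cong (preimage e) W≡⊥) (preimage-⊥ e))
            (λ W≡C̄ → trans (cong (preimage e) W≡C̄) (preimage-classOf-induced e e' e⊆e' c))
            (proj₂ (indec/ c) W W⊆C̄ (splitsWithin-/ₑ f e e' e⊆e' c W splitsZ))
    where
    W⊆C̄ : W ⊆′ classOf ē c
    W⊆C̄ a a∈W = ∈-classOf⁺ ē (∈-classOf⁻ e' (Z⊆C' (rep e a)
      (trans (lookup-preimage e W (rep e a)) (trans (cong (lookup W) (cls-rep e a)) a∈W))))

module SmallDelta {n} (f : BFun n) (f⊥ : f ⊥ ≡ 0ℤ) (e e' : Equiv n) (e⊆e' : e ⊆ₑ e') where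

  private
    ē = induced e e' e⊆e'
    f/⊥ = /ₑ-⊥ f f⊥ e
    f∣⊥ = ∣ₑ-⊥ f f⊥ e'

    IC-/ₑ-/ₑ⁺ : ∀ {j} → IC (f /ₑ e') j → IC ((f /ₑ e) /ₑ ē) j
    IC-/ₑ-/ₑ⁺ = IC-cong λ B → sym (/ₑ-/ₑ-induced f e e' e⊆e' B)

    IC-/ₑ-/ₑ⁻ : ∀ {j} → IC ((f /ₑ e) /ₑ ē) j → IC (f /ₑ e') j
    IC-/ₑ-/ₑ⁻ = IC-cong (/ₑ-/ₑ-induced f e e' e⊆e')

    IC-∣ₑ-/ₑ⁺ : ∀ {j} → IC ((f /ₑ e) ∣ₑ ē) j → IC ((f ∣ₑ e') /ₑ e) j
    IC-∣ₑ-/ₑ⁺ = IC-cong λ B → sym (∣ₑ-/ₑ f e e' e⊆e' B)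

    IC-∣ₑ-/ₑ⁻ : ∀ {j} → IC ((f ∣ₑ e') /ₑ e) j → IC ((f /ₑ e) ∣ₑ ē) j
    IC-∣ₑ-/ₑ⁻ = IC-cong (∣ₑ-/ₑ f e e' e⊆e')

  forward : ES f e × ES (f /ₑ e) ē → ES f e' × ES (f ∣ₑ e') e
  forward (es@(_ , _ , ic/ , ic) , es/@(_ , _ , ic// , ic/′)) =
      ES⁺ f f⊥ e' indec' (IC-/ₑ-/ₑ⁻ ic//) (subst (IC f) (IC-unique (f /ₑ e) f/⊥ ic/ ic/′) ic)
    , ES⁺ (f ∣ₑ e') f∣⊥ e (ClassesIndec-∣ₑ⁺ f f⊥ e e' e⊆e' indec)
          (IC-∣ₑ-/ₑ⁺ (IC-∣ₑ (f /ₑ e) f/⊥ ē indec/)) (IC-∣ₑ f f⊥ e' indec')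
    where
    indec = ES⇒ClassesIndec f f⊥ e es
    indec/ = ES⇒ClassesIndec (f /ₑ e) f/⊥ ē es/
    indec' = ClassesIndec-glue f e e' e⊆e' indec indec/

  backward : ES f e' × ES (f ∣ₑ e') e → ES f e × ES (f /ₑ e) ē
  backward (es'@(_ , j , ic/' , ic) , es∣@(_ , i , ic∣/ , ic∣)) =
      ES⁺ f f⊥ e indec ic/ (subst (IC f) j≡q ic)
    , ES⁺ (f /ₑ e) f/⊥ ē indec/ (IC-/ₑ-/ₑ⁺ (subst (IC (f /ₑ e')) j≡q ic/')) ic/
    where
    indec' = ES⇒ClassesIndec f f⊥ e' es'
    indec = ClassesIndec-∣ₑ⁻ f f⊥ e e' e⊆e' (ES⇒ClassesIndec (f ∣ₑ e') f∣⊥ e es∣)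
    i≡cl : i ≡ cl e'
    i≡cl = IC-unique (f ∣ₑ e') f∣⊥ ic∣ (IC-∣ₑ f f⊥ e' indec')
    indec/ = IC-∣ₑ⇒ClassesIndec (f /ₑ e) f/⊥ ē (IC-∣ₑ-/ₑ⁻ (subst (IC ((f ∣ₑ e') /ₑ e)) i≡cl ic∣/))
    q = proj₁ (IC-exists (f /ₑ e) f/⊥)
    ic/ = proj₂ (IC-exists (f /ₑ e) f/⊥)
    j≡q : j ≡ q
    j≡q = ℕP.≤-antisym (IC≤IC-/ₑ f f⊥ e indec ic ic/) (IC≤IC-/ₑ (f /ₑ e) f/⊥ ē indec/ ic/ (IC-/ₑ-/ₑ⁺ ic/'))

ES-smallDelta : SmallDeltaCond ES
ES-smallDelta f f⊥ e e' e⊆e' = mk⇔ forward backward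
  where open SmallDelta f f⊥ e e' e⊆e'

-- The ⋆₁ condition

-- f/∼' is the quotient of f/∼ by the induced equivalence, whose classes are singletons.
IC-/ₑ-resp-≈ₑ : ∀ {n} (f : BFun n) → f ⊥ ≡ 0ℤ → (e e' : Equiv n) → e ≈ₑ e' →
                ∀ {j} → IC (f /ₑ e) j → IC (f /ₑ e') j
IC-/ₑ-resp-≈ₑ f f⊥ e e' e≈e' ic/ =
  subst (IC (f /ₑ e')) (sym (ℕP.≤-antisym (≤-≈ₑ e e' e≈e' ic/ ic/') (≤-≈ₑ e' e (≈ₑ-sym e e' e≈e') ic/' ic/))) ic/'
  where
  ic/' = proj₂ (IC-exists (f /ₑ e') (/ₑ-⊥ f f⊥ e'))
  ≤-≈ₑ : ∀ e e' → e ≈ₑ e' → ∀ {i j} → IC (f /ₑ e) i → IC (f /ₑ e') j → i ≤ j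
  ≤-≈ₑ e e' e≈e' ic/ ic/' =
    IC≤IC-/ₑ (f /ₑ e) (/ₑ-⊥ f f⊥ e) (induced e e' e⊆e') (ClassesIndec-induced-⊇ e e' e⊆e' (≈ₑ⇒⊇ₑ e e' e≈e') (f /ₑ e))
             ic/ (IC-cong (λ B → sym (/ₑ-/ₑ-induced f e e' e⊆e' B)) ic/')
    where e⊆e' = ≈ₑ⇒⊆ₑ e e' e≈e'

ES-resp-≈ₑ : ∀ {n} (f : BFun n) → f ⊥ ≡ 0ℤ → (e e' : Equiv n) → e ≈ₑ e' → ES f e → ES f e'
ES-resp-≈ₑ f f⊥ e e' e≈e' es@(_ , _ , ic/ , ic) =
  ES⁺ f f⊥ e' (ClassesIndec-resp f e e' (≈ₑ⇒⊆ₑ e e' e≈e') (≈ₑ⇒⊇ₑ e e' e≈e') (ES⇒ClassesIndec f f⊥ e es))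
      (IC-/ₑ-resp-≈ₑ f f⊥ e e' e≈e' ic/) ic

record SubsetEmbedding (m N : ℕ) : Set where
  field
    ι         : Subset m → Subset N
    injective : ∀ {A B} → ι A ≡ ι B → A ≡ B
    ι-⊥       : ι ⊥ ≡ ⊥
    ι-∩       : ∀ A B → ι (A ∩ B) ≡ ι A ∩ ι B
    ι-∖       : ∀ A B → ι (A ∩ ∁ B) ≡ ι A ∩ ∁ (ι B)
    ι-image   : ∀ {A C} → A ⊆′ ι C → Σ[ A' ∈ Subset m ] A' ⊆′ C × A ≡ ι A'

module _ {m N} (E : SubsetEmbedding m N) where
  open SubsetEmbedding E

  ι-⊆′ : ∀ {A B} → A ⊆′ B → ι A ⊆′ ι B
  ι-⊆′ {A} {B} A⊆B = ∩≡⇒⊆′ (trans (sym (ι-∩ A B)) (cong ι (⊆′⇒∩≡ A⊆B)))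

  Nonempty′-ι⁺ : ∀ {C} → Nonempty′ C → Nonempty′ (ι C)
  Nonempty′-ι⁺ {C} C≢∅ with nonempty-or-⊥ (ι C)
  ... | inj₁ ιC≢∅ = ιC≢∅
  ... | inj₂ ιC≡⊥ = contradiction (injective (trans ιC≡⊥ (sym ι-⊥))) (Nonempty′⇒≢⊥ C≢∅)

  Nonempty′-ι⁻ : ∀ {C} → Nonempty′ (ι C) → Nonempty′ C
  Nonempty′-ι⁻ {C} ιC≢∅ with nonempty-or-⊥ C
  ... | inj₁ C≢∅ = C≢∅
  ... | inj₂ C≡⊥ = contradiction (trans (cong ι C≡⊥) ι-⊥) (Nonempty′⇒≢⊥ ιC≢∅)

  module _ {f : BFun m} {h : BFun N} (h∘ι≗f : ∀ A → h (ι A) ≡ f A) where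

    ι-splits⁻ : ∀ {A Z} → h (ι A) ≡ h (ι A ∩ ∁ (ι Z)) +ℤ h (ι A ∩ ι Z) → f A ≡ f (A ∩ ∁ Z) +ℤ f (A ∩ Z)
    ι-splits⁻ {A} {Z} splits = begin
      f A                                      ≡⟨ sym (h∘ι≗f A) ⟩
      h (ι A)                                  ≡⟨ splits ⟩
      h (ι A ∩ ∁ (ι Z)) +ℤ h (ι A ∩ ι Z)       ≡⟨ sym (cong₂ _+ℤ_ (cong h (ι-∖ A Z)) (cong h (ι-∩ A Z))) ⟩
      h (ι (A ∩ ∁ Z)) +ℤ h (ι (A ∩ Z))         ≡⟨ cong₂ _+ℤ_ (h∘ι≗f _) (h∘ι≗f _) ⟩
      f (A ∩ ∁ Z) +ℤ f (A ∩ Z)                 ∎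

    ι-splits⁺ : ∀ {A Z} → f A ≡ f (A ∩ ∁ Z) +ℤ f (A ∩ Z) → h (ι A) ≡ h (ι A ∩ ∁ (ι Z)) +ℤ h (ι A ∩ ι Z)
    ι-splits⁺ {A} {Z} splits = begin
      h (ι A)                                  ≡⟨ h∘ι≗f A ⟩
      f A                                      ≡⟨ splits ⟩
      f (A ∩ ∁ Z) +ℤ f (A ∩ Z)                 ≡⟨ sym (cong₂ _+ℤ_ (h∘ι≗f _) (h∘ι≗f _)) ⟩
      h (ι (A ∩ ∁ Z)) +ℤ h (ι (A ∩ Z))         ≡⟨ cong₂ _+ℤ_ (cong h (ι-∖ A Z)) (cong h (ι-∩ A Z)) ⟩
      h (ι A ∩ ∁ (ι Z)) +ℤ h (ι A ∩ ι Z)       ∎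

    Indec-ι⁺ : ∀ {C} → Indec f C → Indec h (ι C)
    Indec-ι⁺ {C} (C≢∅ , indec) = Nonempty′-ι⁺ C≢∅ , λ Z Z⊆ιC → ⊥-or-ιC (ι-image Z⊆ιC)
      where
      ⊥-or-ιC : ∀ {Z} → Σ[ Z' ∈ Subset m ] Z' ⊆′ C × Z ≡ ι Z' → SplitsWithin h (ι C) Z → Z ≡ ⊥ ⊎ Z ≡ ι C
      ⊥-or-ιC (Z' , Z'⊆C , refl) splitsZ =
        Sum.map (λ Z'≡⊥ → trans (cong ι Z'≡⊥) ι-⊥) (cong ι)
                (indec Z' Z'⊆C λ A A⊆C → ι-splits⁻ (splitsZ (ι A) (ι-⊆′ A⊆C)))

    Indec-ι⁻ : ∀ {C} → Indec h (ι C) → Indec f C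
    Indec-ι⁻ {C} (ιC≢∅ , indec) = Nonempty′-ι⁻ ιC≢∅ , λ Z Z⊆C splitsZ →
      Sum.map (λ ιZ≡⊥ → injective (trans ιZ≡⊥ (sym ι-⊥))) injective
              (indec (ι Z) (ι-⊆′ Z⊆C) λ A A⊆ιC → splits-image splitsZ (ι-image A⊆ιC))
      where
      splits-image : ∀ {A Z} → SplitsWithin f C Z → Σ[ A' ∈ Subset m ] A' ⊆′ C × A ≡ ι A' →
                     h A ≡ h (A ∩ ∁ (ι Z)) +ℤ h (A ∩ ι Z)
      splits-image splitsZ (A' , A'⊆C , refl) = ι-splits⁺ (splitsZ A' A'⊆C)

++-split : ∀ m {n} {P : Subset (m + n) → Set} → (∀ u v → P (u ++ v)) → ∀ A → P A
++-split m {P = P} P-++ A = subst P (VecP.take++drop≡id m A) (P-++ (take m A) (drop m A))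

↑-cases : ∀ m n (z : Fin (m + n)) → (∃[ x ] x ↑ˡ n ≡ z) ⊎ (∃[ y ] m ↑ʳ y ≡ z)
↑-cases m n z with splitAt m z in eq
... | inj₁ x = inj₁ (x , FinP.splitAt⁻¹-↑ˡ eq)
... | inj₂ y = inj₂ (y , FinP.splitAt⁻¹-↑ʳ eq)

↑ˡ≢↑ʳ : ∀ {m n} (x : Fin m) (y : Fin n) → x ↑ˡ n ≢ m ↑ʳ y
↑ˡ≢↑ʳ {m} {n} x y eq with trans (sym (FinP.splitAt-↑ˡ m x n)) (trans (cong (splitAt m) eq) (FinP.splitAt-↑ʳ m n y))
... | ()

⊥++⊥ : ∀ m {n} → ⊥ {m} ++ ⊥ {n} ≡ ⊥
⊥++⊥ zero    = refl
⊥++⊥ (suc m) = cong (false ∷_) (⊥++⊥ m)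

++-∩ : ∀ {m n} (a c : Subset m) (b d : Subset n) → (a ++ b) ∩ (c ++ d) ≡ (a ∩ c) ++ (b ∩ d)
++-∩ a c b d = VecP.zipWith-++ _∧_ a b c d

++-∖ : ∀ {m n} (a c : Subset m) (b d : Subset n) → (a ++ b) ∩ ∁ (c ++ d) ≡ (a ∩ ∁ c) ++ (b ∩ ∁ d)
++-∖ a c b d = trans (cong ((a ++ b) ∩_) (VecP.map-++ not c d)) (++-∩ a (∁ c) b (∁ d))

++-⊆′⁻ : ∀ {m n} (a c : Subset m) (b d : Subset n) → a ++ b ⊆′ c ++ d → a ⊆′ c × b ⊆′ d
++-⊆′⁻ {m} {n} a c b d ab⊆cd =
  (λ x x∈a → trans (sym (VecP.lookup-++ˡ c d x)) (ab⊆cd (x ↑ˡ n) (trans (VecP.lookup-++ˡ a b x) x∈a))) ,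
  (λ y y∈b → trans (sym (VecP.lookup-++ʳ c d y)) (ab⊆cd (m ↑ʳ y) (trans (VecP.lookup-++ʳ a b y) y∈b)))

embedˡ : ∀ m n → SubsetEmbedding m (m + n)
embedˡ m n = record
  { ι         = λ A → A ++ ⊥ {n}
  ; injective = λ {A} {B} → VecP.++-injectiveˡ A B
  ; ι-⊥       = ⊥++⊥ m
  ; ι-∩       = λ A B → sym (trans (++-∩ A B ⊥ ⊥) (cong ((A ∩ B) ++_) (SubsetP.∩-zeroˡ ⊥)))
  ; ι-∖       = λ A B → sym (trans (++-∖ A B ⊥ ⊥) (cong ((A ∩ ∁ B) ++_) (SubsetP.∩-zeroˡ (∁ ⊥))))
  ; ι-image   = λ {A} {C} → image {A} {C}
  }
  where
  image : ∀ {A C} → A ⊆′ C ++ ⊥ → Σ[ A' ∈ Subset m ] A' ⊆′ C × A ≡ A' ++ ⊥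
  image {A} {C} = ++-split m {P = λ A → A ⊆′ C ++ ⊥ → Σ[ A' ∈ Subset m ] A' ⊆′ C × A ≡ A' ++ ⊥}
    (λ u v uv⊆C⊥ → u , proj₁ (++-⊆′⁻ u C v ⊥ uv⊆C⊥) , cong (u ++_) (⊆′⊥⇒≡⊥ (proj₂ (++-⊆′⁻ u C v ⊥ uv⊆C⊥)))) A

embedʳ : ∀ m n → SubsetEmbedding n (m + n)
embedʳ m n = record
  { ι         = λ B → ⊥ {m} ++ B
  ; injective = VecP.++-injectiveʳ ⊥ ⊥
  ; ι-⊥       = ⊥++⊥ m
  ; ι-∩       = λ A B → sym (trans (++-∩ ⊥ ⊥ A B) (cong (_++ (A ∩ B)) (SubsetP.∩-zeroˡ ⊥)))
  ; ι-∖       = λ A B → sym (trans (++-∖ ⊥ ⊥ A B) (cong (_++ (A ∩ ∁ B)) (SubsetP.∩-zeroˡ (∁ ⊥))))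
  ; ι-image   = λ {A} {C} → image {A} {C}
  }
  where
  image : ∀ {B C} → B ⊆′ ⊥ ++ C → Σ[ B' ∈ Subset n ] B' ⊆′ C × B ≡ ⊥ ++ B'
  image {B} {C} = ++-split m {P = λ B → B ⊆′ ⊥ ++ C → Σ[ B' ∈ Subset n ] B' ⊆′ C × B ≡ ⊥ ++ B'}
    (λ u v uv⊆⊥C → v , proj₂ (++-⊆′⁻ u ⊥ v C uv⊆⊥C) , cong (_++ v) (⊆′⊥⇒≡⊥ (proj₁ (++-⊆′⁻ u ⊥ v C uv⊆⊥C)))) B

take-++ : ∀ {X : Set} {m n} (u : Vec X m) (v : Vec X n) → take m (u ++ v) ≡ u
take-++ {m = m} u v = VecP.++-injectiveˡ (take m (u ++ v)) u (VecP.take++drop≡id m (u ++ v))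

drop-++ : ∀ {X : Set} {m n} (u : Vec X m) (v : Vec X n) → drop m (u ++ v) ≡ v
drop-++ {m = m} u v = VecP.++-injectiveʳ (take m (u ++ v)) u (VecP.take++drop≡id m (u ++ v))

⋆₁-++ : ∀ {m n} (f : BFun m) (g : BFun n) u v → (f ⋆₁ g) (u ++ v) ≡ f u +ℤ g v
⋆₁-++ f g u v = cong₂ _+ℤ_ (cong f (take-++ u v)) (cong g (drop-++ u v))

⋆₁-++⊥ : ∀ {m n} (f : BFun m) (g : BFun n) → g ⊥ ≡ 0ℤ → ∀ u → (f ⋆₁ g) (u ++ ⊥) ≡ f u
⋆₁-++⊥ f g g⊥ u = trans (⋆₁-++ f g u ⊥) (trans (cong (f u +ℤ_) g⊥) (ℤP.+-identityʳ (f u)))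

⋆₁-⊥++ : ∀ {m n} (f : BFun m) (g : BFun n) → f ⊥ ≡ 0ℤ → ∀ v → (f ⋆₁ g) (⊥ ++ v) ≡ g v
⋆₁-⊥++ f g f⊥ v = trans (⋆₁-++ f g ⊥ v) (trans (cong (_+ℤ g v) f⊥) (ℤP.+-identityˡ (g v)))

⋆₁-⊥ : ∀ {m n} (f : BFun m) (g : BFun n) → f ⊥ ≡ 0ℤ → g ⊥ ≡ 0ℤ → (f ⋆₁ g) ⊥ ≡ 0ℤ
⋆₁-⊥ {m} f g f⊥ g⊥ = trans (cong (f ⋆₁ g) (sym (⊥++⊥ m))) (trans (⋆₁-++⊥ f g g⊥ ⊥) f⊥)

⌊≟⌋-injective : ∀ {a b} (h : Fin a → Fin b) → (∀ {u v} → h u ≡ h v → u ≡ v) → ∀ u v → ⌊ h u ≟ h v ⌋ ≡ ⌊ u ≟ v ⌋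
⌊≟⌋-injective h h-injective u v with u ≟ v | h u ≟ h v
... | yes _   | yes _     = refl
... | no  _   | no  _     = refl
... | yes u≡v | no hu≢hv  = contradiction (cong h u≡v) hu≢hv
... | no  u≢v | yes hu≡hv = contradiction (h-injective hu≡hv) u≢v

cls-⊔ˡ : ∀ {m n} (eX : Equiv m) (eY : Equiv n) x → cls (eX ⊔ₑ eY) (x ↑ˡ n) ≡ cls eX x ↑ˡ k eY
cls-⊔ˡ {m} {n} eX eY x rewrite FinP.splitAt-↑ˡ m x n = refl

cls-⊔ʳ : ∀ {m n} (eX : Equiv m) (eY : Equiv n) y → cls (eX ⊔ₑ eY) (m ↑ʳ y) ≡ k eX ↑ʳ cls eY y
cls-⊔ʳ {m} {n} eX eY y rewrite FinP.splitAt-↑ʳ m n y = refl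

classOf-⊔ˡ : ∀ {m n} (eX : Equiv m) (eY : Equiv n) a → classOf (eX ⊔ₑ eY) (a ↑ˡ k eY) ≡ classOf eX a ++ ⊥
classOf-⊔ˡ {m} {n} eX eY a = lookup-ext λ z → atom (↑-cases m n z)
  where
  atom : ∀ {z} → (∃[ x ] x ↑ˡ n ≡ z) ⊎ (∃[ y ] m ↑ʳ y ≡ z) →
         lookup (classOf (eX ⊔ₑ eY) (a ↑ˡ k eY)) z ≡ lookup (classOf eX a ++ ⊥) z
  atom (inj₁ (x , refl)) = begin
    lookup (classOf (eX ⊔ₑ eY) (a ↑ˡ k eY)) (x ↑ˡ n)  ≡⟨ lookup-classOf (eX ⊔ₑ eY) (a ↑ˡ k eY) (x ↑ˡ n) ⟩
    ⌊ cls (eX ⊔ₑ eY) (x ↑ˡ n) ≟ a ↑ˡ k eY ⌋            ≡⟨ cong (λ c → ⌊ c ≟ a ↑ˡ k eY ⌋) (cls-⊔ˡ eX eY x) ⟩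
    ⌊ cls eX x ↑ˡ k eY ≟ a ↑ˡ k eY ⌋
      ≡⟨ ⌊≟⌋-injective (_↑ˡ k eY) (FinP.↑ˡ-injective (k eY) _ _) (cls eX x) a ⟩
    ⌊ cls eX x ≟ a ⌋                                   ≡⟨ sym (lookup-classOf eX a x) ⟩
    lookup (classOf eX a) x                            ≡⟨ sym (VecP.lookup-++ˡ (classOf eX a) ⊥ x) ⟩
    lookup (classOf eX a ++ ⊥) (x ↑ˡ n)                ∎
  atom (inj₂ (y , refl)) =
    trans (∉-classOf (eX ⊔ₑ eY) λ y∈a → ↑ˡ≢↑ʳ a (cls eY y) (trans (sym y∈a) (cls-⊔ʳ eX eY y)))
          (sym (trans (VecP.lookup-++ʳ (classOf eX a) ⊥ y) (lookup-⊥ y)))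

classOf-⊔ʳ : ∀ {m n} (eX : Equiv m) (eY : Equiv n) b → classOf (eX ⊔ₑ eY) (k eX ↑ʳ b) ≡ ⊥ ++ classOf eY b
classOf-⊔ʳ {m} {n} eX eY b = lookup-ext λ z → atom (↑-cases m n z)
  where
  atom : ∀ {z} → (∃[ x ] x ↑ˡ n ≡ z) ⊎ (∃[ y ] m ↑ʳ y ≡ z) →
         lookup (classOf (eX ⊔ₑ eY) (k eX ↑ʳ b)) z ≡ lookup (⊥ ++ classOf eY b) z
  atom (inj₁ (x , refl)) =
    trans (∉-classOf (eX ⊔ₑ eY) λ x∈b → ↑ˡ≢↑ʳ (cls eX x) b (trans (sym (cls-⊔ˡ eX eY x)) x∈b))
          (sym (trans (VecP.lookup-++ˡ (⊥ {m}) (classOf eY b) x) (lookup-⊥ x)))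
  atom (inj₂ (y , refl)) = begin
    lookup (classOf (eX ⊔ₑ eY) (k eX ↑ʳ b)) (m ↑ʳ y)  ≡⟨ lookup-classOf (eX ⊔ₑ eY) (k eX ↑ʳ b) (m ↑ʳ y) ⟩
    ⌊ cls (eX ⊔ₑ eY) (m ↑ʳ y) ≟ k eX ↑ʳ b ⌋            ≡⟨ cong (λ c → ⌊ c ≟ k eX ↑ʳ b ⌋) (cls-⊔ʳ eX eY y) ⟩
    ⌊ k eX ↑ʳ cls eY y ≟ k eX ↑ʳ b ⌋
      ≡⟨ ⌊≟⌋-injective (k eX ↑ʳ_) (FinP.↑ʳ-injective (k eX) _ _) (cls eY y) b ⟩
    ⌊ cls eY y ≟ b ⌋                                   ≡⟨ sym (lookup-classOf eY b y) ⟩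
    lookup (classOf eY b) y                            ≡⟨ sym (VecP.lookup-++ʳ (⊥ {m}) (classOf eY b) y) ⟩
    lookup (⊥ ++ classOf eY b) (m ↑ʳ y)                ∎

preimage-⊔ : ∀ {m n} (eX : Equiv m) (eY : Equiv n) u v →
             preimage (eX ⊔ₑ eY) (u ++ v) ≡ preimage eX u ++ preimage eY v
preimage-⊔ {m} {n} eX eY u v = lookup-ext λ z → atom (↑-cases m n z)
  where
  atom : ∀ {z} → (∃[ x ] x ↑ˡ n ≡ z) ⊎ (∃[ y ] m ↑ʳ y ≡ z) →
         lookup (preimage (eX ⊔ₑ eY) (u ++ v)) z ≡ lookup (preimage eX u ++ preimage eY v) z
  atom (inj₁ (x , refl)) = begin
    lookup (preimage (eX ⊔ₑ eY) (u ++ v)) (x ↑ˡ n)   ≡⟨ lookup-preimage (eX ⊔ₑ eY) (u ++ v) (x ↑ˡ n) ⟩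
    lookup (u ++ v) (cls (eX ⊔ₑ eY) (x ↑ˡ n))        ≡⟨ cong (lookup (u ++ v)) (cls-⊔ˡ eX eY x) ⟩
    lookup (u ++ v) (cls eX x ↑ˡ k eY)               ≡⟨ VecP.lookup-++ˡ u v (cls eX x) ⟩
    lookup u (cls eX x)                              ≡⟨ sym (lookup-preimage eX u x) ⟩
    lookup (preimage eX u) x
      ≡⟨ sym (VecP.lookup-++ˡ (preimage eX u) (preimage eY v) x) ⟩
    lookup (preimage eX u ++ preimage eY v) (x ↑ˡ n) ∎
  atom (inj₂ (y , refl)) = begin
    lookup (preimage (eX ⊔ₑ eY) (u ++ v)) (m ↑ʳ y)   ≡⟨ lookup-preimage (eX ⊔ₑ eY) (u ++ v) (m ↑ʳ y) ⟩
    lookup (u ++ v) (cls (eX ⊔ₑ eY) (m ↑ʳ y))        ≡⟨ cong (lookup (u ++ v)) (cls-⊔ʳ eX eY y) ⟩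
    lookup (u ++ v) (k eX ↑ʳ cls eY y)               ≡⟨ VecP.lookup-++ʳ u v (cls eY y) ⟩
    lookup v (cls eY y)                              ≡⟨ sym (lookup-preimage eY v y) ⟩
    lookup (preimage eY v) y
      ≡⟨ sym (VecP.lookup-++ʳ (preimage eX u) (preimage eY v) y) ⟩
    lookup (preimage eX u ++ preimage eY v) (m ↑ʳ y) ∎

module _ {m n} (f : BFun m) (g : BFun n) (f⊥ : f ⊥ ≡ 0ℤ) (g⊥ : g ⊥ ≡ 0ℤ) where

  private
    h = f ⋆₁ g

  ClassesIndec-⊔⁺ : (eX : Equiv m) (eY : Equiv n) → ClassesIndec f eX → ClassesIndec g eY →
                    ClassesIndec (f ⋆₁ g) (eX ⊔ₑ eY)
  ClassesIndec-⊔⁺ eX eY indecX indecY ℓ with ↑-cases (k eX) (k eY) ℓ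
  ... | inj₁ (a , refl) =
    subst (Indec h) (sym (classOf-⊔ˡ eX eY a)) (Indec-ι⁺ (embedˡ m n) (⋆₁-++⊥ f g g⊥) (indecX a))
  ... | inj₂ (b , refl) =
    subst (Indec h) (sym (classOf-⊔ʳ eX eY b)) (Indec-ι⁺ (embedʳ m n) (⋆₁-⊥++ f g f⊥) (indecY b))

  ClassesIndec-⊔⁻ : (eX : Equiv m) (eY : Equiv n) → ClassesIndec (f ⋆₁ g) (eX ⊔ₑ eY) →
                    ClassesIndec f eX × ClassesIndec g eY
  ClassesIndec-⊔⁻ eX eY indec =
    (λ a → Indec-ι⁻ (embedˡ m n) (⋆₁-++⊥ f g g⊥) (subst (Indec h) (classOf-⊔ˡ eX eY a) (indec (a ↑ˡ k eY)))) ,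
    (λ b → Indec-ι⁻ (embedʳ m n) (⋆₁-⊥++ f g f⊥) (subst (Indec h) (classOf-⊔ʳ eX eY b) (indec (k eX ↑ʳ b))))

  splitsAlong-⊔ : (eX : Equiv m) (eY : Equiv n) → SplitsAlong f eX → SplitsAlong g eY →
                  SplitsAlong (f ⋆₁ g) (eX ⊔ₑ eY)
  splitsAlong-⊔ eX eY splitX splitY = ++-split m λ u v → begin
    h (u ++ v)                                                                  ≡⟨ ⋆₁-++ f g u v ⟩
    f u +ℤ g v
      ≡⟨ cong₂ _+ℤ_ (splitX u) (splitY v) ⟩
    sumFin (λ a → f (u ∩ classOf eX a)) +ℤ sumFin (λ b → g (v ∩ classOf eY b))
      ≡⟨ sym (cong₂ _+ℤ_ (sumFin-cong (left u v)) (sumFin-cong (right u v))) ⟩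
    sumFin (λ a → h ((u ++ v) ∩ classOf (eX ⊔ₑ eY) (a ↑ˡ k eY))) +ℤ
    sumFin (λ b → h ((u ++ v) ∩ classOf (eX ⊔ₑ eY) (k eX ↑ʳ b)))
      ≡⟨ sym (sumFin-↑ (k eX) (k eY) _) ⟩
    (h ∣ₑ (eX ⊔ₑ eY)) (u ++ v)                                                  ∎
    where
    left : ∀ u v a → h ((u ++ v) ∩ classOf (eX ⊔ₑ eY) (a ↑ˡ k eY)) ≡ f (u ∩ classOf eX a)
    left u v a = begin
      h ((u ++ v) ∩ classOf (eX ⊔ₑ eY) (a ↑ˡ k eY))  ≡⟨ cong (λ S → h ((u ++ v) ∩ S)) (classOf-⊔ˡ eX eY a) ⟩
      h ((u ++ v) ∩ (classOf eX a ++ ⊥))             ≡⟨ cong h (++-∩ u (classOf eX a) v ⊥) ⟩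
      h ((u ∩ classOf eX a) ++ (v ∩ ⊥))
        ≡⟨ cong (λ S → h ((u ∩ classOf eX a) ++ S)) (SubsetP.∩-zeroʳ v) ⟩
      h ((u ∩ classOf eX a) ++ ⊥)                    ≡⟨ ⋆₁-++⊥ f g g⊥ (u ∩ classOf eX a) ⟩
      f (u ∩ classOf eX a)                           ∎
    right : ∀ u v b → h ((u ++ v) ∩ classOf (eX ⊔ₑ eY) (k eX ↑ʳ b)) ≡ g (v ∩ classOf eY b)
    right u v b = begin
      h ((u ++ v) ∩ classOf (eX ⊔ₑ eY) (k eX ↑ʳ b))  ≡⟨ cong (λ S → h ((u ++ v) ∩ S)) (classOf-⊔ʳ eX eY b) ⟩
      h ((u ++ v) ∩ (⊥ ++ classOf eY b))             ≡⟨ cong h (++-∩ u ⊥ v (classOf eY b)) ⟩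
      h ((u ∩ ⊥) ++ (v ∩ classOf eY b))
        ≡⟨ cong (λ S → h (S ++ (v ∩ classOf eY b))) (SubsetP.∩-zeroʳ u) ⟩
      h (⊥ ++ (v ∩ classOf eY b))                    ≡⟨ ⋆₁-⊥++ f g f⊥ (v ∩ classOf eY b) ⟩
      g (v ∩ classOf eY b)                           ∎

  IC-⋆₁ : ∀ {i j} → IC f i → IC g j → IC (f ⋆₁ g) (i + j)
  IC-⋆₁ (eX , decompX@(splitX , _) , refl) (eY , decompY@(splitY , _) , refl) =
    eX ⊔ₑ eY ,
    IsIndecDecomp⁺ h (eX ⊔ₑ eY) (splitsAlong-⊔ eX eY splitX splitY)
      (ClassesIndec-⊔⁺ eX eY (IsIndecDecomp⇒ClassesIndec f f⊥ eX decompX)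
                             (IsIndecDecomp⇒ClassesIndec g g⊥ eY decompY)) ,
    refl

  /ₑ-⊔ : (eX : Equiv m) (eY : Equiv n) → ∀ B → ((f ⋆₁ g) /ₑ (eX ⊔ₑ eY)) B ≡ ((f /ₑ eX) ⋆₁ (g /ₑ eY)) B
  /ₑ-⊔ eX eY = ++-split (k eX) λ u v →
    trans (cong h (preimage-⊔ eX eY u v)) (trans (⋆₁-++ f g _ _) (sym (⋆₁-++ (f /ₑ eX) (g /ₑ eY) u v)))

  private
    R : Subset (m + n)
    R = ⊥ {m} ++ ⊤ {n}

    splitsAt-R : SplitsAt h R
    splitsAt-R = ++-split m λ u v → begin
      h (u ++ v)                                   ≡⟨ ⋆₁-++ f g u v ⟩
      f u +ℤ g v                                   ≡⟨ sym (cong₂ _+ℤ_ (⋆₁-++⊥ f g g⊥ u) (⋆₁-⊥++ f g f⊥ v)) ⟩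
      h (u ++ ⊥) +ℤ h (⊥ ++ v)                     ≡⟨ sym (cong₂ _+ℤ_ (cong h (∖R u v)) (cong h (∩R u v))) ⟩
      h ((u ++ v) ∩ ∁ R) +ℤ h ((u ++ v) ∩ R)       ∎
      where
      ∖R : ∀ u v → (u ++ v) ∩ ∁ R ≡ u ++ ⊥
      ∖R u v = trans (++-∖ u ⊥ v ⊤) (cong₂ _++_
        (⊆′⇒∩≡ {A = u} {∁ ⊥} λ x _ → trans (lookup-∁ ⊥ x) (cong not (lookup-⊥ x)))
        (disjoint⇒∩≡⊥ {A = v} {∁ ⊤} λ y _ → trans (lookup-∁ ⊤ y) (cong not (lookup-⊤ y))))
      ∩R : ∀ u v → (u ++ v) ∩ R ≡ ⊥ ++ v
      ∩R u v = trans (++-∩ u ⊥ v ⊤) (cong₂ _++_ (SubsetP.∩-zeroʳ u) (SubsetP.∩-identityʳ v))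

  ClassesIndec⇒no-crossing : (e : Equiv (m + n)) → ClassesIndec (f ⋆₁ g) e → ∀ x y → cls e (x ↑ˡ n) ≢ cls e (m ↑ʳ y)
  ClassesIndec⇒no-crossing e indec x y x~y =
    contradiction (absurd (Indec-∩-splitsWithin h {Y' = Y} (indec (cls e (x ↑ˡ n))) (λ _ p → p) (λ A _ → splitsAt-R A)))
                  λ ()
    where
    Y = classOf e (cls e (x ↑ˡ n))
    x∉R : lookup R (x ↑ˡ n) ≡ false
    x∉R = trans (VecP.lookup-++ˡ (⊥ {m}) ⊤ x) (lookup-⊥ x)
    y∈Y∩R : lookup (Y ∩ R) (m ↑ʳ y) ≡ true
    y∈Y∩R = ∈-∩⁺ {A = Y} {R} (m ↑ʳ y) (∈-classOf⁺ e (sym x~y)) (trans (VecP.lookup-++ʳ (⊥ {m}) ⊤ y) (lookup-⊤ y))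
    absurd : Y ∩ R ≡ ⊥ ⊎ Y ∩ R ≡ Y → true ≡ false
    absurd (inj₁ Y∩R≡⊥) = trans (sym y∈Y∩R) (trans (cong (λ S → lookup S (m ↑ʳ y)) Y∩R≡⊥) (lookup-⊥ (m ↑ʳ y)))
    absurd (inj₂ Y∩R≡Y) =
      trans (sym (∩-⊆′ʳ Y R (x ↑ˡ n) (subst (λ S → lookup S (x ↑ˡ n) ≡ true) (sym Y∩R≡Y) (∈-classOf⁺ e refl)))) x∉R

≈ₑ-⊔-kernels : ∀ {m n} (e : Equiv (m + n)) → (∀ x y → cls e (x ↑ˡ n) ≢ cls e (m ↑ʳ y)) →
               e ≈ₑ (proj₁ (kernel λ x → cls e (x ↑ˡ n)) ⊔ₑ proj₁ (kernel λ y → cls e (m ↑ʳ y)))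
≈ₑ-⊔-kernels {m} {n} e no-crossing z w = cases (↑-cases m n z) (↑-cases m n w)
  where
  eX = proj₁ (kernel λ x → cls e (x ↑ˡ n))
  eY = proj₁ (kernel λ y → cls e (m ↑ʳ y))
  e⊔ = eX ⊔ₑ eY
  cases : ∀ {z w} → (∃[ x ] x ↑ˡ n ≡ z) ⊎ (∃[ y ] m ↑ʳ y ≡ z) → (∃[ x ] x ↑ˡ n ≡ w) ⊎ (∃[ y ] m ↑ʳ y ≡ w) →
          (cls e z ≡ cls e w) ⇔ (cls e⊔ z ≡ cls e⊔ w)
  cases (inj₁ (x , refl)) (inj₁ (x' , refl)) = mk⇔
    (λ p → trans (cls-⊔ˡ eX eY x) (trans (cong (_↑ˡ k eY) (Equivalence.from (proj₂ (kernel _) x x') p))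
                                        (sym (cls-⊔ˡ eX eY x'))))
    (λ p → Equivalence.to (proj₂ (kernel _) x x')
             (FinP.↑ˡ-injective (k eY) _ _ (trans (sym (cls-⊔ˡ eX eY x)) (trans p (cls-⊔ˡ eX eY x')))))
  cases (inj₂ (y , refl)) (inj₂ (y' , refl)) = mk⇔
    (λ p → trans (cls-⊔ʳ eX eY y) (trans (cong (k eX ↑ʳ_) (Equivalence.from (proj₂ (kernel _) y y') p))
                                        (sym (cls-⊔ʳ eX eY y'))))
    (λ p → Equivalence.to (proj₂ (kernel _) y y')
             (FinP.↑ʳ-injective (k eX) _ _ (trans (sym (cls-⊔ʳ eX eY y)) (trans p (cls-⊔ʳ eX eY y')))))
  cases (inj₁ (x , refl)) (inj₂ (y , refl)) = mk⇔
    (λ p → contradiction p (no-crossing x y))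
    (λ p → contradiction (trans (sym (cls-⊔ˡ eX eY x)) (trans p (cls-⊔ʳ eX eY y))) (↑ˡ≢↑ʳ _ _))
  cases (inj₂ (y , refl)) (inj₁ (x , refl)) = mk⇔
    (λ p → contradiction (sym p) (no-crossing x y))
    (λ p → contradiction (trans (sym (cls-⊔ˡ eX eY x)) (trans (sym p) (cls-⊔ʳ eX eY y))) (↑ˡ≢↑ʳ _ _))

+-≤-≡ : ∀ {a b c d} → a ≤ c → b ≤ d → a + b ≡ c + d → a ≡ c × b ≡ d
+-≤-≡ {a} {b} {c} {d} a≤c b≤d a+b≡c+d = a≡c , ℕP.+-cancelˡ-≡ c b d (trans (cong (_+ b) (sym a≡c)) a+b≡c+d)
  where
  a≡c : a ≡ c
  a≡c = ℕP.≤-antisym a≤c (ℕP.+-cancelʳ-≤ b c a (subst (c + b ≤_) (sym a+b≡c+d) (ℕP.+-monoʳ-≤ c b≤d)))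

module _ {m n} (f : BFun m) (g : BFun n) (f⊥ : f ⊥ ≡ 0ℤ) (g⊥ : g ⊥ ≡ 0ℤ) where

  private
    h = f ⋆₁ g
    h⊥ = ⋆₁-⊥ f g f⊥ g⊥
    f/⊥ = /ₑ-⊥ f f⊥
    g/⊥ = /ₑ-⊥ g g⊥

  IC-/ₑ-⊔ : (eX : Equiv m) (eY : Equiv n) → ∀ {i j} → IC (f /ₑ eX) i → IC (g /ₑ eY) j →
            IC (h /ₑ (eX ⊔ₑ eY)) (i + j)
  IC-/ₑ-⊔ eX eY icX/ icY/ =
    IC-cong (λ B → sym (/ₑ-⊔ f g f⊥ g⊥ eX eY B)) (IC-⋆₁ (f /ₑ eX) (g /ₑ eY) (f/⊥ eX) (g/⊥ eY) icX/ icY/)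

  ES-⊔⁺ : (eX : Equiv m) (eY : Equiv n) → ES f eX → ES g eY → ES h (eX ⊔ₑ eY)
  ES-⊔⁺ eX eY esX@(_ , _ , icX/ , icX) esY@(_ , _ , icY/ , icY) =
    ES⁺ h h⊥ (eX ⊔ₑ eY) (ClassesIndec-⊔⁺ f g f⊥ g⊥ eX eY (ES⇒ClassesIndec f f⊥ eX esX) (ES⇒ClassesIndec g g⊥ eY esY))
        (IC-/ₑ-⊔ eX eY icX/ icY/) (IC-⋆₁ f g f⊥ g⊥ icX icY)

  ES-⊔⁻ : (eX : Equiv m) (eY : Equiv n) → ES h (eX ⊔ₑ eY) → ES f eX × ES g eY
  ES-⊔⁻ eX eY es@(_ , _ , ic/ , ic) =
    ES⁺ f f⊥ eX indecX icX/ (subst (IC f) (proj₁ i≡q) icX) , ES⁺ g g⊥ eY indecY icY/ (subst (IC g) (proj₂ i≡q) icY)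
    where
    indecX = proj₁ (ClassesIndec-⊔⁻ f g f⊥ g⊥ eX eY (ES⇒ClassesIndec h h⊥ (eX ⊔ₑ eY) es))
    indecY = proj₂ (ClassesIndec-⊔⁻ f g f⊥ g⊥ eX eY (ES⇒ClassesIndec h h⊥ (eX ⊔ₑ eY) es))
    icX = proj₂ (IC-exists f f⊥)
    icY = proj₂ (IC-exists g g⊥)
    icX/ = proj₂ (IC-exists (f /ₑ eX) (f/⊥ eX))
    icY/ = proj₂ (IC-exists (g /ₑ eY) (g/⊥ eY))
    i≡q = +-≤-≡ (IC≤IC-/ₑ f f⊥ eX indecX icX icX/) (IC≤IC-/ₑ g g⊥ eY indecY icY icY/)
                (trans (IC-unique h h⊥ (IC-⋆₁ f g f⊥ g⊥ icX icY) ic)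
                       (IC-unique (h /ₑ (eX ⊔ₑ eY)) (/ₑ-⊥ h h⊥ (eX ⊔ₑ eY)) ic/ (IC-/ₑ-⊔ eX eY icX/ icY/)))

  ES-⋆₁ : (e : Equiv (m + n)) →
          ES h e ⇔ (Σ[ eX ∈ Equiv m ] Σ[ eY ∈ Equiv n ] ES f eX × ES g eY × (e ≈ₑ (eX ⊔ₑ eY)))
  ES-⋆₁ e = mk⇔ to from
    where
    to : ES h e → Σ[ eX ∈ Equiv m ] Σ[ eY ∈ Equiv n ] ES f eX × ES g eY × (e ≈ₑ (eX ⊔ₑ eY))
    to es = eX , eY , proj₁ (ES-⊔⁻ eX eY es⊔) , proj₂ (ES-⊔⁻ eX eY es⊔) , e≈e⊔
      where
      eX = proj₁ (kernel λ x → cls e (x ↑ˡ n))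
      eY = proj₁ (kernel λ y → cls e (m ↑ʳ y))
      e≈e⊔ : e ≈ₑ (eX ⊔ₑ eY)
      e≈e⊔ = ≈ₑ-⊔-kernels e (ClassesIndec⇒no-crossing f g f⊥ g⊥ e (ES⇒ClassesIndec h h⊥ e es))
      es⊔ = ES-resp-≈ₑ h h⊥ e (eX ⊔ₑ eY) e≈e⊔ es
    from : (Σ[ eX ∈ Equiv m ] Σ[ eY ∈ Equiv n ] ES f eX × ES g eY × (e ≈ₑ (eX ⊔ₑ eY))) → ES h e
    from (eX , eY , esX , esY , e≈e⊔) =
      ES-resp-≈ₑ h h⊥ (eX ⊔ₑ eY) e (≈ₑ-sym e (eX ⊔ₑ eY) e≈e⊔) (ES-⊔⁺ eX eY esX esY)

ES-star₁ : Star1Cond ES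
ES-star₁ = (λ e → ES-resp-≈ₑ one refl (idEq 0) e (λ ()) (ES-idEq one refl)) , ES-⋆₁

-- Failure of the Δ condition

-- The restrictions of f to {0, 1} and {2} are indecomposable,
-- so their indiscrete equivalences lie in E^S, but their union ∼ does not: ic(f) = 1 while f/∼ is modular.
counterexample : BFun 3
counterexample (true ∷ true  ∷ _    ∷ []) = + 1
counterexample (true ∷ false ∷ true ∷ []) = + 1
counterexample _                          = 0ℤ

-- The implicit argument is filled in by evaluating the decision procedure for proper splittings.
IsIndecDecomp-indiscrete : ∀ {n} (g : BFun (suc n)) → g ⊥ ≡ 0ℤ →
                           {_ : DecP.False (properSplitting? g (indiscrete n))} → IsIndecDecomp g (indiscrete n)
IsIndecDecomp-indiscrete {n} g g⊥ {no-proper-splitting} =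
  IsIndecDecomp⁺ g (indiscrete n) (proj₂ (coarsestSplitting g g⊥))
    (¬ProperSplitting⇒ClassesIndec g (indiscrete n) (DecP.toWitnessFalse no-proper-splitting))

IC-counterexample : IC counterexample 1
IC-counterexample = indiscrete 2 , IsIndecDecomp-indiscrete counterexample refl , refl

ES-counterexample-left : ES (restrictL {2} {1} counterexample) (indiscrete 1)
ES-counterexample-left = ES-indecDecomp (restrictL {2} {1} counterexample) refl (indiscrete 1)
  (IsIndecDecomp-indiscrete (restrictL {2} {1} counterexample) refl)

ES-counterexample-right : ES (restrictR {2} {1} counterexample) (indiscrete 0)
ES-counterexample-right = ES-indecDecomp (restrictR {2} {1} counterexample) refl (indiscrete 0)
  (IsIndecDecomp-indiscrete (restrictR {2} {1} counterexample) refl)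

counterexample-quotient-splits : SplitsAlong (counterexample /ₑ (indiscrete 1 ⊔ₑ indiscrete 0)) (idEq 2)
counterexample-quotient-splits (true  ∷ true  ∷ []) = refl
counterexample-quotient-splits (true  ∷ false ∷ []) = refl
counterexample-quotient-splits (false ∷ true  ∷ []) = refl
counterexample-quotient-splits (false ∷ false ∷ []) = refl

ES-¬bigDelta : ¬ BigDeltaCond ES
ES-¬bigDelta bigDelta
  with Equivalence.from (bigDelta {2} {1} counterexample refl (indiscrete 1) (indiscrete 0))
                        (ES-counterexample-left , ES-counterexample-right)
... | _ , _ , ic/ , ic = contradiction
  (trans (IC-unique counterexample refl IC-counterexample ic)
         (IC-unique (counterexample /ₑ e⊔) refl ic/ (IC-/ₑ-cl counterexample e⊔ counterexample-quotient-splits)))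
  λ ()
  where e⊔ = indiscrete 1 ⊔ₑ indiscrete 0

theorem3p17 : Star1Cond ES × ¬ BigDeltaCond ES × SmallDeltaCond ES × EpsilonCond ES
theorem3p17 = ES-star₁ , ES-¬bigDelta , ES-smallDelta , ES-epsilon
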